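{- The map $\mathrm{Act}_Y'=\mathrm{Act}_Y\circ\Phi_{p,q\to x}:\mathrm{Sol}'\to Q\Lambda$ is an isomorphism. Concretely, $\mathrm{Act}_Y'(h)$ is the function sending a Young diagram $\lambda$ with multirectangular coordinates $(p_1,\dots,p_m;q_1,\dots,q_m)$ to $h_m(p_1,\dots,p_m;q_1,\dots,q_m)$.
   Context: Stable polynomials in $X$: sequences $f=(f_n)_{n\ge0}$, $f_n\in\mathbb{C}[x_1,\dots,x_n]$, of bounded degree, with $f_{n+1}(x_1,\dots,x_n,0)=f_n$. $\mathrm{Sol}$: stable $f$ with $f_n|_{x_{i+1}=x_i}=f_{n-2}(x_1,\dots,x_{i-1},x_{i+2},\dots,x_n)$ for all $n\ge2$, $1\le i<n$. Every Young diagram $\lambda$ is written uniquely with $m\ge0$ and positive integers $p_i,q_i$ (its multirectangular coordinates) such that $\lambda$ consists of $p_1$ rows of length $q_1+\dots+q_m$, then $p_2$ rows of length $q_2+\dots+q_m$, ..., $p_m$ rows of length $q_m$; its interlacing coordinates are $\mathrm{IC}(\lambda)=(x_1,\dots,x_{2m+1})$ with $x_{2i+1}=(q_{i+1}+\dots+q_m)-(p_1+\dots+p_i)$ ($0\le i\le m$), $x_{2i}=(q_i+\dots+q_m)-(p_1+\dots+p_i)$ ($1\le i\le m$). $\mathrm{Act}_Y(f)$ is the function $\lambda\mapsto f_{2m+1}(\mathrm{IC}(\lambda))$, and $Q\Lambda=\mathrm{Act}_Y(\mathrm{Sol})$. Stable polynomials in $\mathbf{p},\mathbf{q}$: $h=(h_m)_{m\ge0}$,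 $h_m\in\mathbb{C}[p_1,\dots,p_m,q_1,\dots,q_m]$, bounded degree, $h_{m+1}(p_1,\dots,p_m,0;q_1,\dots,q_m,0)=h_m$. $\mathrm{Sol}'$: such $h$ satisfying for all $m\ge1$, $1\le i\le m$: (Q) $h_m|_{q_i=0}=h_{m-1}(p_1,\dots,p_{i-1},p_i+p_{i+1},p_{i+2},\dots,p_m;q_1,\dots,q_{i-1},q_{i+1},\dots,q_m)$ for $i<m$ and $h_m|_{q_m=0}=h_{m-1}(p_1,\dots,p_{m-1};q_1,\dots,q_{m-1})$; (P) $h_m|_{p_i=0}=h_{m-1}(p_1,\dots,p_{i-1},p_{i+1},\dots,p_m;q_1,\dots,q_{i-2},q_{i-1}+q_i,q_{i+1},\dots,q_m)$ for $i>1$ and $h_m|_{p_1=0}=h_{m-1}(p_2,\dots,p_m;q_2,\dots,q_m)$. $\Phi_{p,q\to x}:\mathrm{Sol}'\to\mathrm{Sol}$ sends $h$ to $f$ with $f_{2m+1}(x_1,\dots,x_{2m+1})=h_m(p;q)$ where $p_i=x_{2i-1}-x_{2i}$, $q_i=x_{2i}-x_{2i+1}$, and $f_{2m}(x_1,\dots,x_{2m})=f_{2m+1}(x_1,\dots,x_{2m},0)$. -}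

module Defs where

open import Level using (0ℓ)
open import Algebra.Bundles using (CommutativeRing)
open import Data.Nat as ℕ using (ℕ; zero; suc; _<?_; ⌊_/2⌋)
open import Data.Bool using (Bool; true; false; if_then_else_)
open import Data.Fin as Fin using (Fin; fromℕ<; toℕ)
open import Data.Vec as Vec using (Vec; []; _∷_; lookup; toList)
open import Data.List as List using (List; drop; take)
open import Data.Nat.ListAction using (sum)
open import Data.Sum using (_⊎_; inj₁; inj₂; [_,_])
open import Data.Product using (∃; _×_)
open import Relation.Nullary using (¬_; yes; no)

-- The coefficient field (the paper uses ℂ): a field of characteristic 0.

natToRing : (R : CommutativeRing 0ℓ 0ℓ) → ℕ → CommutativeRing.Carrier R
natToRing R zero    = CommutativeRing.0# R
natToRing R (suc n) = CommutativeRing._+_ R (CommutativeRing.1# R) (natToRing R n)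

record CharZeroField : Set₁ where
  field
    cring : CommutativeRing 0ℓ 0ℓ
  open CommutativeRing cring
  field
    1≉0      : ¬ (1# ≈ 0#)
    inverse  : ∀ x → ¬ (x ≈ 0#) → ∃ λ y → (x * y) ≈ 1#
    charZero : ∀ n → ¬ (natToRing cring (suc n) ≈ 0#)

-- A polynomial is represented by an expression; two expressions denote the
-- same polynomial iff they agree at every point (K infinite).

module Theory (F : CharZeroField) where
  open CharZeroField F
  open CommutativeRing cring renaming (Carrier to K)

  ι : ℕ → K
  ι = natToRing cring

  data Poly (V : Set) : Set where
    var  : V → Poly V
    con  : K → Poly V
    _⊕_  : Poly V → Poly V → Poly V
    _⊗_  : Poly V → Poly V → Poly V

  eval : {V : Set} → (V → K) → Poly V → K
  eval ρ (var v) = ρ v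
  eval ρ (con c) = c
  eval ρ (a ⊕ b) = eval ρ a + eval ρ b
  eval ρ (a ⊗ b) = eval ρ a * eval ρ b

  -- syntactic degree (an upper bound for the degree of the polynomial)
  deg : {V : Set} → Poly V → ℕ
  deg (var _) = 1
  deg (con _) = 0
  deg (a ⊕ b) = deg a ℕ.⊔ deg b
  deg (a ⊗ b) = deg a ℕ.+ deg b

  _≐_ : {V : Set} → Poly V → Poly V → Set
  a ≐ b = ∀ ρ → eval ρ a ≈ eval ρ b

  HasDegree≤ : {V : Set} → Poly V → ℕ → Set
  HasDegree≤ a d = ∃ λ b → (deg b ℕ.≤ d) × (b ≐ a)

  subst : {V W : Set} → (V → Poly W) → Poly V → Poly W
  subst σ (var v) = σ v
  subst σ (con c) = con c
  subst σ (a ⊕ b) = subst σ a ⊕ subst σ b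
  subst σ (a ⊗ b) = subst σ a ⊗ subst σ b

  _⊖_ : {V : Set} → Poly V → Poly V → Poly V
  a ⊖ b = a ⊕ (con (- 1#) ⊗ b)

  -- f n ∈ K[x_1,…,x_n]  (variable x_{k+1} is Fin index k)
  SeqX : Set
  SeqX = (n : ℕ) → Poly (Fin n)

  evalX : ∀ {n} → SeqX → Vec K n → K
  evalX {n} f x = eval (lookup x) (f n)

  BoundedDegX : SeqX → Set
  BoundedDegX f = ∃ λ d → ∀ n → HasDegree≤ (f n) d

  StableX : SeqX → Set
  StableX f = ∀ n (x : Vec K n) →
    evalX f (Vec.insertAt x (Fin.fromℕ n) 0#) ≈ evalX f x

  -- f_n |_{x_{i+1} = x_i} = f_{n-2}(x_1,…,x_{i-1},x_{i+2},…,x_n),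
  -- n = k+2, 1 ≤ i ≤ k+1 (i = 1 + toℕ j)
  CancelX : SeqX → Set
  CancelX f = ∀ k (y : Vec K k) (j : Fin (suc k)) (a : K) →
    evalX f (Vec.insertAt (Vec.insertAt y j a) (Fin.suc j) a) ≈ evalX f y

  IsSol : SeqX → Set
  IsSol f = BoundedDegX f × StableX f × CancelX f

  -- h m ∈ K[p_1,…,p_m,q_1,…,q_m]; inj₁ k is p_{k+1}, inj₂ k is q_{k+1}
  SeqPQ : Set
  SeqPQ = (m : ℕ) → Poly (Fin m ⊎ Fin m)

  evalPQ : ∀ {m} → SeqPQ → Vec K m → Vec K m → K
  evalPQ {m} h p q = eval [ lookup p , lookup q ] (h m)

  BoundedDegPQ : SeqPQ → Set
  BoundedDegPQ h = ∃ λ d → ∀ m → HasDegree≤ (h m) d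

  StablePQ : SeqPQ → Set
  StablePQ h = ∀ m (p q : Vec K m) →
    evalPQ h (Vec.insertAt p (Fin.fromℕ m) 0#) (Vec.insertAt q (Fin.fromℕ m) 0#)
      ≈ evalPQ h p q

  mergeAt : ∀ {n} → Fin n → Vec K (suc n) → Vec K n
  mergeAt Fin.zero    (a ∷ b ∷ xs) = (a + b) ∷ xs
  mergeAt (Fin.suc j) (a ∷ xs)     = a ∷ mergeAt j xs

  -- condition (Q), m = k+1.  Case i < m with i = 1 + toℕ j, and case i = m.
  CondQ : SeqPQ → Set
  CondQ h =
    (∀ k (j : Fin k) (p : Vec K (suc k)) (q : Vec K k) →
       evalPQ h p (Vec.insertAt q (Fin.inject₁ j) 0#) ≈ evalPQ h (mergeAt j p) q)
    ×
    (∀ k (p : Vec K (suc k)) (q : Vec K k) →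
       evalPQ h p (Vec.insertAt q (Fin.fromℕ k) 0#)
         ≈ evalPQ h (Vec.removeAt p (Fin.fromℕ k)) q)

  -- condition (P), m = k+1.  Case i > 1 with i = 2 + toℕ j, and case i = 1.
  CondP : SeqPQ → Set
  CondP h =
    (∀ k (j : Fin k) (p : Vec K k) (q : Vec K (suc k)) →
       evalPQ h (Vec.insertAt p (Fin.suc j) 0#) q ≈ evalPQ h p (mergeAt j q))
    ×
    (∀ k (p : Vec K k) (q : Vec K (suc k)) →
       evalPQ h (Vec.insertAt p Fin.zero 0#) q
         ≈ evalPQ h p (Vec.removeAt q Fin.zero))

  IsSol' : SeqPQ → Set
  IsSol' h = BoundedDegPQ h × StablePQ h × CondQ h × CondP h

  xvar : (n k : ℕ) → Poly (Fin n)
  xvar n k with k <? n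
  ... | yes k<n = var (fromℕ< k<n)
  ... | no  _   = con 0#

  -- p_{j+1} ↦ x_{2j+1} - x_{2j+2},  q_{j+1} ↦ x_{2j+2} - x_{2j+3}
  -- (1-based x), for n = 2m+1 directly and for n = 2m with x_{2m+1} = 0.
  Φσ : (n m : ℕ) → Fin m ⊎ Fin m → Poly (Fin n)
  Φσ n m (inj₁ j) = xvar n (2 ℕ.* toℕ j) ⊖ xvar n (suc (2 ℕ.* toℕ j))
  Φσ n m (inj₂ j) = xvar n (suc (2 ℕ.* toℕ j)) ⊖ xvar n (2 ℕ.+ 2 ℕ.* toℕ j)

  Φpq→x : SeqPQ → SeqX
  Φpq→x h n = subst (Φσ n ⌊ n /2⌋) (h ⌊ n /2⌋)

  -- Young diagrams, via their (unique) multirectangular coordinates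

  record YoungDiagram : Set where
    field
      m   : ℕ
      p q : Vec ℕ m
      p-pos : ∀ i → 0 ℕ.< lookup p i
      q-pos : ∀ i → 0 ℕ.< lookup q i

  isEven : ℕ → Bool
  isEven zero          = true
  isEven (suc zero)    = false
  isEven (suc (suc n)) = isEven n

  -- 0-based k-th interlacing coordinate (x_{k+1} in the paper):
  -- x_{2i+1} = (q_{i+1}+…+q_m) - (p_1+…+p_i),
  -- x_{2i}   = (q_i+…+q_m)     - (p_1+…+p_i).
  icAt : YoungDiagram → ℕ → K
  icAt λ' k =
    if isEven k
    then ι (sum (drop i (toList q))) - ι (sum (take i (toList p)))
    else ι (sum (drop i (toList q))) - ι (sum (take (suc i) (toList p)))
    where
      open YoungDiagram λ'
      i = ⌊ k /2⌋

  IC : (λ' : YoungDiagram) → Vec K (suc (YoungDiagram.m λ' ℕ.+ YoungDiagram.m λ'))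
  IC λ' = Vec.tabulate (λ k → icAt λ' (toℕ k))

  ActY : SeqX → YoungDiagram → K
  ActY f λ' = evalX f (IC λ')

  ActY' : SeqPQ → YoungDiagram → K
  ActY' h λ' = evalPQ h (Vec.map ι p) (Vec.map ι q)
    where open YoungDiagram λ'

  _≃PQ_ : SeqPQ → SeqPQ → Set
  h ≃PQ h' = ∀ m → h m ≐ h' m

module Submission where

-- In the coordinates p_i = x_{2i-1} - x_{2i}, q_i = x_{2i} - x_{2i+1} of
-- Φ_{p,q→x}, whose inverse expresses each interlacing coordinate as a suffix
-- sum of the q's minus a prefix sum of the p's, cancelling two equal adjacent
-- x's is the same as setting one p_i or q_i to 0 and merging its neighbours.
-- So (P) and (Q) for h correspond to the cancellation rule for Φ_{p,q→x} h,
-- and conversely m ↦ f_{2m+1}(IC(p; q)) lies in Sol' for f in Sol. Since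
-- Act_Y evaluates at interlacing coordinates, Act_Y ∘ Φ_{p,q→x} evaluates h_m
-- at multirectangular coordinates; these range over all positive integers,
-- which in characteristic 0 determine a polynomial, hence injectivity.

open import Defs
open import Level using (0ℓ)
open import Algebra.Bundles using (CommutativeRing)
open import Algebra.Solver.Ring.AlmostCommutativeRing
  using (_-Raw-AlmostCommutative⟶_; fromCommutativeRing)
import Algebra.Properties.AbelianGroup as AbelianGroupProperties
import Algebra.Properties.Ring as RingProperties
open import Data.Bool using (true; false; if_then_else_)
open import Data.Nat as ℕ using (ℕ; zero; suc; ⌊_/2⌋; z≤n; s≤s; z<s; s<s; _<?_)
import Data.Nat.Properties as ℕP
open import Data.Integer as ℤ using ()
import Data.Integer.Properties as ℤP
open import Data.Sign as Sign using (Sign)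
open import Data.Fin as Fin using (Fin; toℕ; fromℕ<)
import Data.Fin.Properties as FinP
open import Data.Vec as Vec using (Vec; []; _∷_; lookup; toList)
import Data.Vec.Properties as VecP
open import Data.List as List using (List; []; _∷_; length; drop; take; _++_)
open import Data.List.Relation.Unary.Any using (here; there)
open import Data.List.Membership.Propositional using (_∈_)
open import Data.List.Membership.Propositional.Properties using (∈-map⁺; ∈-++⁺ˡ; ∈-++⁺ʳ; ∈-allFin)
open import Data.Nat.ListAction using (sum)
open import Data.Maybe using (Maybe; just; nothing)
open import Function using (_∘_)
open import Data.Sum using (_⊎_; inj₁; inj₂; [_,_])
import Data.Sum.Properties as SumP
open import Data.Product using (∃; _×_; _,_; proj₁; proj₂)
open import Data.Empty using (⊥-elim)
open import Relation.Nullary using (¬_; yes; no)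
open import Relation.Binary.Definitions using (DecidableEquality; tri<; tri≈; tri>)
open import Relation.Binary.PropositionalEquality as P using (_≡_; cong; cong₂)

double : ℕ → ℕ
double zero    = zero
double (suc n) = suc (suc (double n))

2*n≡double : ∀ n → 2 ℕ.* n ≡ double n
2*n≡double zero    = P.refl
2*n≡double (suc n) = cong suc (P.trans (ℕP.+-suc n (n ℕ.+ 0)) (cong suc (2*n≡double n)))

double≡n+n : ∀ n → double n ≡ n ℕ.+ n
double≡n+n zero    = P.refl
double≡n+n (suc n) = cong suc (P.trans (cong suc (double≡n+n n)) (P.sym (ℕP.+-suc n n)))

half-double : ∀ n → ⌊ double n /2⌋ ≡ n
half-double zero    = P.refl
half-double (suc n) = cong suc (half-double n)

half-suc-double : ∀ n → ⌊ suc (double n) /2⌋ ≡ n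
half-suc-double zero    = P.refl
half-suc-double (suc n) = cong suc (half-suc-double n)

double-mono-≤ : ∀ {m n} → m ℕ.≤ n → double m ℕ.≤ double n
double-mono-≤ z≤n       = z≤n
double-mono-≤ (s≤s m≤n) = s≤s (s≤s (double-mono-≤ m≤n))

double-mono-< : ∀ {m n} → m ℕ.< n → suc (suc (double m)) ℕ.≤ double n
double-mono-< m<n = double-mono-≤ m<n

data Parity : ℕ → Set where
  even : ∀ n → Parity (double n)
  odd  : ∀ n → Parity (suc (double n))

parity : ∀ n → Parity n
parity zero = even zero
parity (suc n) with parity n
... | even k = odd k
... | odd k  = even (suc k)

half-suc : ∀ n → ⌊ suc n /2⌋ ≡ ⌊ n /2⌋
               ⊎ (⌊ suc n /2⌋ ≡ suc ⌊ n /2⌋ × n ≡ suc (double ⌊ n /2⌋))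
half-suc n with parity n
... | even k = inj₁ (P.trans (half-suc-double k) (P.sym (half-double k)))
... | odd k  = inj₂ ( cong suc (P.trans (half-double k) (P.sym (half-suc-double k)))
                    , cong (λ z → suc (double z)) (P.sym (half-suc-double k)))

half-mono-≡ˡ : ∀ {a b c} → a ℕ.≤ b → ⌊ b /2⌋ ≡ c → ⌊ a /2⌋ ℕ.≤ c
half-mono-≡ˡ a≤b P.refl = ℕP.⌊n/2⌋-mono a≤b

half-mono-≡ʳ : ∀ {a b c} → a ℕ.≤ b → ⌊ a /2⌋ ≡ c → c ℕ.≤ ⌊ b /2⌋
half-mono-≡ʳ a≤b P.refl = ℕP.⌊n/2⌋-mono a≤b

data PairPosition (j : ℕ) : ℕ → Set where
  before : ∀ {l} → l ℕ.< j → PairPosition j l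
  first  : PairPosition j j
  second : PairPosition j (suc j)
  after  : ∀ l → j ℕ.≤ l → PairPosition j (suc (suc l))

pairPosition : ∀ j l → PairPosition j l
pairPosition zero    zero          = first
pairPosition zero    (suc zero)    = second
pairPosition zero    (suc (suc l)) = after l z≤n
pairPosition (suc j) zero          = before z<s
pairPosition (suc j) (suc l) with pairPosition j l
... | before l<j = before (s<s l<j)
... | first      = first
... | second     = second
... | after l' j≤l' = after (suc l') (s≤s j≤l')

-- The ring solver of the standard library needs coefficients with decidable
-- equality; we use ℤ, mapped into an arbitrary commutative ring.
module IntegerCoefficients (R : CommutativeRing 0ℓ 0ℓ) where
  open CommutativeRing R
  open ℤ using (ℤ; +_; -[1+_]; +0; +[1+_])
  open import Relation.Binary.Reasoning.Setoid setoid
  private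
    module RP = RingProperties ring
    module AG = AbelianGroupProperties +-abelianGroup

  ι : ℕ → Carrier
  ι = natToRing R

  ι-+ : ∀ a b → ι (a ℕ.+ b) ≈ ι a + ι b
  ι-+ zero    b = sym (+-identityˡ _)
  ι-+ (suc a) b = trans (+-congˡ (ι-+ a b)) (sym (+-assoc _ _ _))

  ι-* : ∀ a b → ι (a ℕ.* b) ≈ ι a * ι b
  ι-* zero    b = sym (zeroˡ _)
  ι-* (suc a) b = begin
    ι (b ℕ.+ a ℕ.* b)     ≈⟨ ι-+ b (a ℕ.* b) ⟩
    ι b + ι (a ℕ.* b)     ≈⟨ +-congˡ (ι-* a b) ⟩
    ι b + ι a * ι b       ≈⟨ +-congʳ (sym (*-identityˡ _)) ⟩
    1# * ι b + ι a * ι b  ≈⟨ sym (distribʳ _ _ _) ⟩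
    (1# + ι a) * ι b      ∎

  ⟦_⟧ℤ : ℤ → Carrier
  ⟦ + n      ⟧ℤ = ι n
  ⟦ -[1+ n ] ⟧ℤ = - ι (suc n)

  ⟦_⟧± : Sign → Carrier
  ⟦ Sign.+ ⟧± = 1#
  ⟦ Sign.- ⟧± = - 1#

  ⟦⟧ℤ-‿homo : ∀ i → ⟦ ℤ.- i ⟧ℤ ≈ - ⟦ i ⟧ℤ
  ⟦⟧ℤ-‿homo -[1+ n ] = sym (RP.-‿involutive _)
  ⟦⟧ℤ-‿homo +0       = sym RP.-0#≈0#
  ⟦⟧ℤ-‿homo +[1+ n ] = refl

  ⟦⟧ℤ-⊖-homo : ∀ m n → ⟦ m ℤ.⊖ n ⟧ℤ ≈ ι m - ι n
  ⟦⟧ℤ-⊖-homo zero    zero    = sym (-‿inverseʳ 0#)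
  ⟦⟧ℤ-⊖-homo zero    (suc n) = sym (+-identityˡ _)
  ⟦⟧ℤ-⊖-homo (suc m) zero    = sym (trans (+-congˡ RP.-0#≈0#) (+-identityʳ _))
  ⟦⟧ℤ-⊖-homo (suc m) (suc n) = begin
    ⟦ suc m ℤ.⊖ suc n ⟧ℤ              ≡⟨ cong ⟦_⟧ℤ (ℤP.[1+m]⊖[1+n]≡m⊖n m n) ⟩
    ⟦ m ℤ.⊖ n ⟧ℤ                      ≈⟨ ⟦⟧ℤ-⊖-homo m n ⟩
    ι m - ι n                         ≈⟨ +-congʳ (sym (+-identityˡ _)) ⟩
    (0# + ι m) - ι n                  ≈⟨ +-congʳ (+-congʳ (sym (-‿inverseʳ 1#))) ⟩
    ((1# - 1#) + ι m) - ι n           ≈⟨ +-congʳ (+-assoc _ _ _) ⟩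
    (1# + (- 1# + ι m)) - ι n         ≈⟨ +-congʳ (+-congˡ (+-comm _ _)) ⟩
    (1# + (ι m - 1#)) - ι n           ≈⟨ +-congʳ (sym (+-assoc _ _ _)) ⟩
    ((1# + ι m) - 1#) - ι n           ≈⟨ +-assoc _ _ _ ⟩
    (1# + ι m) + (- 1# - ι n)         ≈⟨ +-congˡ (AG.⁻¹-∙-comm 1# (ι n)) ⟩
    (1# + ι m) - (1# + ι n)           ∎

  ⟦⟧ℤ-+-homo : ∀ i j → ⟦ i ℤ.+ j ⟧ℤ ≈ ⟦ i ⟧ℤ + ⟦ j ⟧ℤ
  ⟦⟧ℤ-+-homo -[1+ m ] -[1+ n ] = begin
    - ι (suc (suc (m ℕ.+ n)))    ≡⟨ cong (λ k → - ι (suc k)) (P.sym (ℕP.+-suc m n)) ⟩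
    - ι (suc m ℕ.+ suc n)        ≈⟨ -‿cong (ι-+ (suc m) (suc n)) ⟩
    - (ι (suc m) + ι (suc n))    ≈⟨ sym (AG.⁻¹-∙-comm _ _) ⟩
    - ι (suc m) + - ι (suc n)    ∎
  ⟦⟧ℤ-+-homo -[1+ m ] (+ n)    = trans (⟦⟧ℤ-⊖-homo n (suc m)) (+-comm _ _)
  ⟦⟧ℤ-+-homo (+ m)    -[1+ n ] = ⟦⟧ℤ-⊖-homo m (suc n)
  ⟦⟧ℤ-+-homo (+ m)    (+ n)    = ι-+ m n

  ⟦⟧ℤ-◃ : ∀ s n → ⟦ s ℤ.◃ n ⟧ℤ ≈ ⟦ s ⟧± * ι n
  ⟦⟧ℤ-◃ s        zero    = sym (zeroʳ _)
  ⟦⟧ℤ-◃ Sign.+ (suc n) = sym (*-identityˡ _)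
  ⟦⟧ℤ-◃ Sign.- (suc n) = trans (-‿cong (sym (*-identityˡ _))) (RP.-‿distribˡ-* _ _)

  ⟦⟧ℤ-sign-abs : ∀ i → ⟦ i ⟧ℤ ≈ ⟦ ℤ.sign i ⟧± * ι ℤ.∣ i ∣
  ⟦⟧ℤ-sign-abs i =
    trans (reflexive (cong ⟦_⟧ℤ (P.sym (ℤP.◃-inverse i)))) (⟦⟧ℤ-◃ (ℤ.sign i) ℤ.∣ i ∣)

  ⟦⟧±-*-homo : ∀ s t → ⟦ s Sign.* t ⟧± ≈ ⟦ s ⟧± * ⟦ t ⟧±
  ⟦⟧±-*-homo Sign.+ t      = sym (*-identityˡ _)
  ⟦⟧±-*-homo Sign.- Sign.+ = sym (*-identityʳ _)
  ⟦⟧±-*-homo Sign.- Sign.- = trans (sym (RP.-‿involutive 1#))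
    (trans (-‿cong (sym (*-identityˡ _))) (RP.-‿distribˡ-* _ _))

  *-interchange : ∀ a b c d → (a * b) * (c * d) ≈ (a * c) * (b * d)
  *-interchange a b c d = begin
    (a * b) * (c * d)  ≈⟨ *-assoc _ _ _ ⟩
    a * (b * (c * d))  ≈⟨ *-congˡ (sym (*-assoc _ _ _)) ⟩
    a * ((b * c) * d)  ≈⟨ *-congˡ (*-congʳ (*-comm _ _)) ⟩
    a * ((c * b) * d)  ≈⟨ *-congˡ (*-assoc _ _ _) ⟩
    a * (c * (b * d))  ≈⟨ sym (*-assoc _ _ _) ⟩
    (a * c) * (b * d)  ∎

  ⟦⟧ℤ-*-homo : ∀ i j → ⟦ i ℤ.* j ⟧ℤ ≈ ⟦ i ⟧ℤ * ⟦ j ⟧ℤ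
  ⟦⟧ℤ-*-homo i j = begin
    ⟦ i ℤ.* j ⟧ℤ
      ≈⟨ ⟦⟧ℤ-◃ (ℤ.sign i Sign.* ℤ.sign j) (ℤ.∣ i ∣ ℕ.* ℤ.∣ j ∣) ⟩
    ⟦ ℤ.sign i Sign.* ℤ.sign j ⟧± * ι (ℤ.∣ i ∣ ℕ.* ℤ.∣ j ∣)
      ≈⟨ *-cong (⟦⟧±-*-homo (ℤ.sign i) (ℤ.sign j)) (ι-* ℤ.∣ i ∣ ℤ.∣ j ∣) ⟩
    (⟦ ℤ.sign i ⟧± * ⟦ ℤ.sign j ⟧±) * (ι ℤ.∣ i ∣ * ι ℤ.∣ j ∣)
      ≈⟨ *-interchange _ _ _ _ ⟩
    (⟦ ℤ.sign i ⟧± * ι ℤ.∣ i ∣) * (⟦ ℤ.sign j ⟧± * ι ℤ.∣ j ∣)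
      ≈⟨ sym (*-cong (⟦⟧ℤ-sign-abs i) (⟦⟧ℤ-sign-abs j)) ⟩
    ⟦ i ⟧ℤ * ⟦ j ⟧ℤ ∎

  ⟦⟧ℤ-morphism : ℤ.+-*-rawRing -Raw-AlmostCommutative⟶ fromCommutativeRing R
  ⟦⟧ℤ-morphism = record
    { ⟦_⟧ = ⟦_⟧ℤ ; +-homo = ⟦⟧ℤ-+-homo ; *-homo = ⟦⟧ℤ-*-homo ; -‿homo = ⟦⟧ℤ-‿homo
    ; 0-homo = refl ; 1-homo = +-identityʳ 1# }

  ⟦⟧ℤ-≟ : ∀ i j → Maybe (⟦ i ⟧ℤ ≈ ⟦ j ⟧ℤ)
  ⟦⟧ℤ-≟ i j with i ℤ.≟ j
  ... | yes P.refl = just refl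
  ... | no _     = nothing

  open import Algebra.Solver.Ring ℤ.+-*-rawRing (fromCommutativeRing R) ⟦⟧ℤ-morphism ⟦⟧ℤ-≟ public
    using (solve; _:=_; _:+_; _:*_; _:-_; con)

module PartialSums {A : Set} (_∙_ : A → A → A) (ε : A) where

  total : ℕ → (ℕ → A) → A
  total zero    X = ε
  total (suc m) X = X 0 ∙ total m (λ t → X (suc t))

  suffixSum : ℕ → (ℕ → A) → ℕ → A
  suffixSum m       X zero    = total m X
  suffixSum zero    X (suc i) = ε
  suffixSum (suc m) X (suc i) = suffixSum m (λ t → X (suc t)) i

  prefixSum : (ℕ → A) → ℕ → A
  prefixSum X zero    = ε
  prefixSum X (suc i) = X 0 ∙ prefixSum (λ t → X (suc t)) i

module _ (F : CharZeroField) where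
  open CharZeroField F
  open Theory F
  open CommutativeRing cring hiding (zero) renaming (Carrier to K)
  open import Relation.Binary.Reasoning.Setoid setoid
  open IntegerCoefficients cring using (ι-+; solve; _:=_; _:+_; _:*_; _:-_)
    renaming (con to κ)
  private module RP = RingProperties ring

  eval-cong : ∀ {V} {ρ ρ' : V → K} → (∀ v → ρ v ≈ ρ' v) → ∀ e → eval ρ e ≈ eval ρ' e
  eval-cong ρ≈ρ' (var v) = ρ≈ρ' v
  eval-cong ρ≈ρ' (con c) = refl
  eval-cong ρ≈ρ' (a ⊕ b) = +-cong (eval-cong ρ≈ρ' a) (eval-cong ρ≈ρ' b)
  eval-cong ρ≈ρ' (a ⊗ b) = *-cong (eval-cong ρ≈ρ' a) (eval-cong ρ≈ρ' b)

  eval-subst : ∀ {V W} (ρ : W → K) (σ : V → Poly W) e →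
    eval ρ (subst σ e) ≡ eval (λ v → eval ρ (σ v)) e
  eval-subst ρ σ (var v) = P.refl
  eval-subst ρ σ (con c) = P.refl
  eval-subst ρ σ (a ⊕ b) = cong₂ _+_ (eval-subst ρ σ a) (eval-subst ρ σ b)
  eval-subst ρ σ (a ⊗ b) = cong₂ _*_ (eval-subst ρ σ a) (eval-subst ρ σ b)

  eval-⊖ : ∀ {V} (ρ : V → K) a b → eval ρ (a ⊖ b) ≈ eval ρ a - eval ρ b
  eval-⊖ ρ a b = +-congˡ (trans (sym (RP.-‿distribˡ-* 1# (eval ρ b))) (-‿cong (*-identityˡ _)))

  deg-subst-linear : ∀ {V W} (σ : V → Poly W) → (∀ v → deg (σ v) ℕ.≤ 1) →
    ∀ e → deg (subst σ e) ℕ.≤ deg e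
  deg-subst-linear σ σ-lin (var v) = σ-lin v
  deg-subst-linear σ σ-lin (con c) = z≤n
  deg-subst-linear σ σ-lin (a ⊕ b) =
    ℕP.⊔-mono-≤ (deg-subst-linear σ σ-lin a) (deg-subst-linear σ σ-lin b)
  deg-subst-linear σ σ-lin (a ⊗ b) =
    ℕP.+-mono-≤ (deg-subst-linear σ σ-lin a) (deg-subst-linear σ σ-lin b)

  HasDegree≤-subst-linear : ∀ {V W} (σ : V → Poly W) → (∀ v → deg (σ v) ℕ.≤ 1) →
    ∀ {e d} → HasDegree≤ e d → HasDegree≤ (subst σ e) d
  HasDegree≤-subst-linear σ σ-lin {e} (b , deg-b≤d , b≐e) =
    subst σ b , ℕP.≤-trans (deg-subst-linear σ σ-lin b) deg-b≤d , λ ρ → begin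
      eval ρ (subst σ b)           ≡⟨ eval-subst ρ σ b ⟩
      eval (λ v → eval ρ (σ v)) b  ≈⟨ b≐e _ ⟩
      eval (λ v → eval ρ (σ v)) e  ≡⟨ P.sym (eval-subst ρ σ e) ⟩
      eval ρ (subst σ e)           ∎

  *-zeroˡ-cancel : ∀ x y → ¬ (x ≈ 0#) → x * y ≈ 0# → y ≈ 0#
  *-zeroˡ-cancel x y x≉0 xy≈0 with inverse x x≉0
  ... | x⁻¹ , xx⁻¹≈1 = begin
    y              ≈⟨ sym (*-identityˡ y) ⟩
    1# * y         ≈⟨ *-congʳ (sym xx⁻¹≈1) ⟩
    (x * x⁻¹) * y  ≈⟨ solve 3 (λ x y z → (x :* z) :* y := z :* (x :* y)) refl x y x⁻¹ ⟩
    x⁻¹ * (x * y)  ≈⟨ *-congˡ xy≈0 ⟩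
    x⁻¹ * 0#       ≈⟨ zeroʳ x⁻¹ ⟩
    0#             ∎

  -- Univariate polynomials as coefficient lists, constant term first.
  horner : List K → K → K
  horner []       t = 0#
  horner (c ∷ cs) t = c + t * horner cs t

  infixl 6 _+ᴸ_
  infixr 7 _·ᴸ_
  infixl 7 _*ᴸ_

  _+ᴸ_ : List K → List K → List K
  []       +ᴸ ys       = ys
  (x ∷ xs) +ᴸ []       = x ∷ xs
  (x ∷ xs) +ᴸ (y ∷ ys) = (x + y) ∷ (xs +ᴸ ys)

  _·ᴸ_ : K → List K → List K
  c ·ᴸ []       = []
  c ·ᴸ (y ∷ ys) = (c * y) ∷ (c ·ᴸ ys)

  _*ᴸ_ : List K → List K → List K
  []       *ᴸ ys = []
  (x ∷ xs) *ᴸ ys = (x ·ᴸ ys) +ᴸ (0# ∷ (xs *ᴸ ys))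

  horner-+ : ∀ xs ys t → horner (xs +ᴸ ys) t ≈ horner xs t + horner ys t
  horner-+ []       ys       t = sym (+-identityˡ _)
  horner-+ (x ∷ xs) []       t = sym (+-identityʳ _)
  horner-+ (x ∷ xs) (y ∷ ys) t = begin
    (x + y) + t * horner (xs +ᴸ ys) t
      ≈⟨ +-congˡ (*-congˡ (horner-+ xs ys t)) ⟩
    (x + y) + t * (horner xs t + horner ys t)
      ≈⟨ solve 5 (λ x y t a b → (x :+ y) :+ t :* (a :+ b) := (x :+ t :* a) :+ (y :+ t :* b))
               refl x y t (horner xs t) (horner ys t) ⟩
    (x + t * horner xs t) + (y + t * horner ys t) ∎

  horner-· : ∀ c ys t → horner (c ·ᴸ ys) t ≈ c * horner ys t
  horner-· c []       t = sym (zeroʳ c)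
  horner-· c (y ∷ ys) t = begin
    c * y + t * horner (c ·ᴸ ys) t  ≈⟨ +-congˡ (*-congˡ (horner-· c ys t)) ⟩
    c * y + t * (c * horner ys t)   ≈⟨ solve 4 (λ c y t a → c :* y :+ t :* (c :* a) := c :* (y :+ t :* a))
                                             refl c y t (horner ys t) ⟩
    c * (y + t * horner ys t)       ∎

  horner-* : ∀ xs ys t → horner (xs *ᴸ ys) t ≈ horner xs t * horner ys t
  horner-* []       ys t = sym (zeroˡ _)
  horner-* (x ∷ xs) ys t = begin
    horner ((x ·ᴸ ys) +ᴸ (0# ∷ (xs *ᴸ ys))) t
      ≈⟨ horner-+ (x ·ᴸ ys) _ t ⟩
    horner (x ·ᴸ ys) t + (0# + t * horner (xs *ᴸ ys) t)
      ≈⟨ +-cong (horner-· x ys t) (+-congˡ (*-congˡ (horner-* xs ys t))) ⟩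
    x * horner ys t + (0# + t * (horner xs t * horner ys t))
      ≈⟨ solve 4 (λ x y t a → x :* y :+ (κ ℤ.0ℤ :+ t :* (a :* y)) := (x :+ t :* a) :* y)
               refl x (horner ys t) t (horner xs t) ⟩
    (x + t * horner xs t) * horner ys t ∎

  syntheticDivision : K → List K → List K
  syntheticDivision a []            = []
  syntheticDivision a (c ∷ [])      = []
  syntheticDivision a (c ∷ c' ∷ cs) = horner (c' ∷ cs) a ∷ syntheticDivision a (c' ∷ cs)

  length-syntheticDivision : ∀ a c cs → length (syntheticDivision a (c ∷ cs)) ≡ length cs
  length-syntheticDivision a c []        = P.refl
  length-syntheticDivision a c (c' ∷ cs) = cong suc (length-syntheticDivision a c' cs)

  horner-syntheticDivision : ∀ a cs t →
    horner cs t ≈ horner cs a + (t - a) * horner (syntheticDivision a cs) t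
  horner-syntheticDivision a [] t =
    solve 2 (λ t a → κ ℤ.0ℤ := κ ℤ.0ℤ :+ (t :- a) :* κ ℤ.0ℤ) refl t a
  horner-syntheticDivision a (c ∷ []) t =
    solve 3 (λ c t a → c :+ t :* κ ℤ.0ℤ := (c :+ a :* κ ℤ.0ℤ) :+ (t :- a) :* κ ℤ.0ℤ) refl c t a
  horner-syntheticDivision a (c ∷ c' ∷ cs) t = begin
    c + t * horner (c' ∷ cs) t
      ≈⟨ +-congˡ (*-congˡ (horner-syntheticDivision a (c' ∷ cs) t)) ⟩
    c + t * (horner (c' ∷ cs) a + (t - a) * horner (syntheticDivision a (c' ∷ cs)) t)
      ≈⟨ solve 5 (λ c t a u v → c :+ t :* (u :+ (t :- a) :* v)
                              := (c :+ a :* u) :+ (t :- a) :* (u :+ t :* v))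
               refl c t a (horner (c' ∷ cs) a) (horner (syntheticDivision a (c' ∷ cs)) t) ⟩
    (c + a * horner (c' ∷ cs) a)
      + (t - a) * (horner (c' ∷ cs) a + t * horner (syntheticDivision a (c' ∷ cs)) t) ∎

  -- A polynomial with infinitely many roots ι (k + 1), ι (k + 2), … is zero:
  -- divide out the first root; the quotient vanishes at all the later ones
  -- because char K = 0 makes each ι (k + 1 + n) - ι (k + 1) invertible.
  horner-vanishing : ∀ fuel cs → length cs ℕ.≤ fuel → ∀ k →
    (∀ n → horner cs (ι (k ℕ.+ suc n)) ≈ 0#) → ∀ t → horner cs t ≈ 0#
  horner-vanishing fuel       []       _ k roots t = refl
  horner-vanishing (suc fuel) (c ∷ cs) (s≤s len≤) k roots t = begin
    horner (c ∷ cs) t                        ≈⟨ horner-syntheticDivision a (c ∷ cs) t ⟩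
    horner (c ∷ cs) a + (t - a) * horner Q t ≈⟨ +-cong (roots 0) (*-congˡ (Q≈0 t)) ⟩
    0# + (t - a) * 0#                        ≈⟨ +-identityˡ _ ⟩
    (t - a) * 0#                             ≈⟨ zeroʳ _ ⟩
    0#                                       ∎
    where
    a = ι (k ℕ.+ 1)
    Q = syntheticDivision a (c ∷ cs)
    Q-roots : ∀ n → horner Q (ι (suc k ℕ.+ suc n)) ≈ 0#
    Q-roots n = *-zeroˡ-cancel (u - a) (horner Q u) u-a≉0 (begin
      (u - a) * horner Q u
        ≈⟨ solve 2 (λ x y → y := (x :+ y) :- x) refl (horner (c ∷ cs) a) _ ⟩
      (horner (c ∷ cs) a + (u - a) * horner Q u) - horner (c ∷ cs) a
        ≈⟨ +-cong (sym (horner-syntheticDivision a (c ∷ cs) u)) (-‿cong (roots 0)) ⟩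
      horner (c ∷ cs) u - 0#
        ≈⟨ +-congʳ (trans (reflexive (cong (λ z → horner (c ∷ cs) (ι z))
                                           (P.sym (ℕP.+-suc k (suc n)))))
                          (roots (suc n))) ⟩
      0# - 0#  ≈⟨ -‿inverseʳ 0# ⟩
      0#       ∎)
      where
      u = ι (suc k ℕ.+ suc n)
      u-a≈ι[1+n] : u - a ≈ ι (suc n)
      u-a≈ι[1+n] = begin
        u - a                          ≡⟨ cong (λ z → ι (z ℕ.+ suc n) - a) (P.sym (ℕP.+-comm k 1)) ⟩
        ι ((k ℕ.+ 1) ℕ.+ suc n) - a    ≈⟨ +-congʳ (ι-+ (k ℕ.+ 1) (suc n)) ⟩
        (a + ι (suc n)) - a            ≈⟨ solve 2 (λ a x → (a :+ x) :- a := x) refl a (ι (suc n)) ⟩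
        ι (suc n)                      ∎
      u-a≉0 : ¬ (u - a ≈ 0#)
      u-a≉0 u-a≈0 = charZero n (trans (sym u-a≈ι[1+n]) u-a≈0)
    Q≈0 : ∀ t → horner Q t ≈ 0#
    Q≈0 = horner-vanishing fuel Q
      (P.subst (ℕ._≤ fuel) (P.sym (length-syntheticDivision a c cs)) len≤) (suc k) Q-roots

  module OneVariableAtATime {V : Set} (_≟V_ : DecidableEquality V) where

    update : (V → K) → V → K → V → K
    update ρ v t w with w ≟V v
    ... | yes _ = t
    ... | no _  = ρ w

    update-self : ∀ ρ v w → update ρ v (ρ v) w ≈ ρ w
    update-self ρ v w with w ≟V v
    ... | yes P.refl = refl
    ... | no _       = refl

    coefficientsIn : (V → K) → V → Poly V → List K
    coefficientsIn ρ v (var w) with w ≟V v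
    ... | yes _ = 0# ∷ 1# ∷ []
    ... | no _  = ρ w ∷ []
    coefficientsIn ρ v (con c) = c ∷ []
    coefficientsIn ρ v (a ⊕ b) = coefficientsIn ρ v a +ᴸ coefficientsIn ρ v b
    coefficientsIn ρ v (a ⊗ b) = coefficientsIn ρ v a *ᴸ coefficientsIn ρ v b

    horner-coefficientsIn : ∀ ρ v e t → horner (coefficientsIn ρ v e) t ≈ eval (update ρ v t) e
    horner-coefficientsIn ρ v (var w) t with w ≟V v
    ... | yes _ = begin
      0# + t * (1# + t * 0#) ≈⟨ +-identityˡ _ ⟩
      t * (1# + t * 0#)      ≈⟨ *-congˡ (trans (+-congˡ (zeroʳ t)) (+-identityʳ 1#)) ⟩
      t * 1#                 ≈⟨ *-identityʳ t ⟩
      t                      ∎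
    ... | no _  = trans (+-congˡ (zeroʳ t)) (+-identityʳ _)
    horner-coefficientsIn ρ v (con c) t = trans (+-congˡ (zeroʳ t)) (+-identityʳ _)
    horner-coefficientsIn ρ v (a ⊕ b) t =
      trans (horner-+ (coefficientsIn ρ v a) (coefficientsIn ρ v b) t)
            (+-cong (horner-coefficientsIn ρ v a t) (horner-coefficientsIn ρ v b t))
    horner-coefficientsIn ρ v (a ⊗ b) t =
      trans (horner-* (coefficientsIn ρ v a) (coefficientsIn ρ v b) t)
            (*-cong (horner-coefficientsIn ρ v a t) (horner-coefficientsIn ρ v b t))

    equal-on-positive-integers : ∀ ρ v e₁ e₂ →
      (∀ n → eval (update ρ v (ι (suc n))) e₁ ≈ eval (update ρ v (ι (suc n))) e₂) →
      ∀ t → eval (update ρ v t) e₁ ≈ eval (update ρ v t) e₂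
    equal-on-positive-integers ρ v e₁ e₂ agree t = begin
      E₁ t                 ≈⟨ solve 2 (λ x y → x := (x :- y) :+ y) refl (E₁ t) (E₂ t) ⟩
      (E₁ t - E₂ t) + E₂ t ≈⟨ +-congʳ (sym (horner-D t)) ⟩
      horner D t + E₂ t    ≈⟨ +-congʳ (horner-vanishing (length D) D ℕP.≤-refl 0 D-roots t) ⟩
      0# + E₂ t            ≈⟨ +-identityˡ _ ⟩
      E₂ t                 ∎
      where
      E₁ E₂ : K → K
      E₁ t = eval (update ρ v t) e₁
      E₂ t = eval (update ρ v t) e₂
      D = coefficientsIn ρ v e₁ +ᴸ ((- 1#) ·ᴸ coefficientsIn ρ v e₂)
      horner-D : ∀ t → horner D t ≈ E₁ t - E₂ t
      horner-D t = begin
        horner D t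
          ≈⟨ horner-+ (coefficientsIn ρ v e₁) ((- 1#) ·ᴸ coefficientsIn ρ v e₂) t ⟩
        horner (coefficientsIn ρ v e₁) t + horner ((- 1#) ·ᴸ coefficientsIn ρ v e₂) t
          ≈⟨ +-cong (horner-coefficientsIn ρ v e₁ t) (horner-· (- 1#) (coefficientsIn ρ v e₂) t) ⟩
        E₁ t + - 1# * horner (coefficientsIn ρ v e₂) t
          ≈⟨ +-congˡ (trans (RP.-1*x≈-x _) (-‿cong (horner-coefficientsIn ρ v e₂ t))) ⟩
        E₁ t - E₂ t ∎
      D-roots : ∀ n → horner D (ι (0 ℕ.+ suc n)) ≈ 0#
      D-roots n = trans (horner-D _) (trans (+-congʳ (agree n)) (-‿inverseʳ _))

    PositiveInteger : K → Set
    PositiveInteger x = ∃ λ n → x ≈ ι (suc n)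

    -- induction on the variables not yet known to take positive integer values
    equal-on-positive-integer-points : ∀ e₁ e₂ →
      (∀ ρ → (∀ v → PositiveInteger (ρ v)) → eval ρ e₁ ≈ eval ρ e₂) →
      ∀ (vs : List V) ρ → (∀ v → ¬ (v ∈ vs) → PositiveInteger (ρ v)) → eval ρ e₁ ≈ eval ρ e₂
    equal-on-positive-integer-points e₁ e₂ agree [] ρ ρ-pos = agree ρ (λ v → ρ-pos v (λ ()))
    equal-on-positive-integer-points e₁ e₂ agree (u ∷ vs) ρ ρ-pos = begin
      eval ρ e₁                  ≈⟨ sym (eval-cong (update-self ρ u) e₁) ⟩
      eval (update ρ u (ρ u)) e₁ ≈⟨ equal-on-positive-integers ρ u e₁ e₂ agree-at-u (ρ u) ⟩
      eval (update ρ u (ρ u)) e₂ ≈⟨ eval-cong (update-self ρ u) e₂ ⟩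
      eval ρ e₂                  ∎
      where
      update-pos : ∀ n w → ¬ (w ∈ vs) → PositiveInteger (update ρ u (ι (suc n)) w)
      update-pos n w w∉vs with w ≟V u
      ... | yes _  = n , refl
      ... | no w≢u = ρ-pos w λ { (here w≡u) → w≢u w≡u ; (there w∈vs) → w∉vs w∈vs }
      agree-at-u : ∀ n → eval (update ρ u (ι (suc n))) e₁ ≈ eval (update ρ u (ι (suc n))) e₂
      agree-at-u n = equal-on-positive-integer-points e₁ e₂ agree vs _ (update-pos n)

  -- Vectors are handled as zero-padded sequences ℕ → K, so that the
  -- insertions and merges in the definitions of Sol and Sol' become
  -- index-free operations on sequences.
  Seq : Set
  Seq = ℕ → K

  toSeq : ∀ {n} → Vec K n → Seq
  toSeq []       k       = 0#
  toSeq (x ∷ xs) zero    = x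
  toSeq (x ∷ xs) (suc k) = toSeq xs k

  tabulateSeq : ∀ n → Seq → Vec K n
  tabulateSeq n X = Vec.tabulate (λ i → X (toℕ i))

  lookup≡toSeq : ∀ {n} (v : Vec K n) i → lookup v i ≡ toSeq v (toℕ i)
  lookup≡toSeq (x ∷ v) Fin.zero    = P.refl
  lookup≡toSeq (x ∷ v) (Fin.suc i) = lookup≡toSeq v i

  toSeq-beyond : ∀ {n} (v : Vec K n) k → n ℕ.≤ k → toSeq v k ≡ 0#
  toSeq-beyond []      k       n≤k       = P.refl
  toSeq-beyond (x ∷ v) (suc k) (s≤s n≤k) = toSeq-beyond v k n≤k

  toSeq-tabulate : ∀ {n} (g : Fin n → K) l (l<n : l ℕ.< n) →
    toSeq (Vec.tabulate g) l ≡ g (fromℕ< l<n)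
  toSeq-tabulate {suc n} g zero    l<n       = P.refl
  toSeq-tabulate {suc n} g (suc l) (s≤s l<n) = toSeq-tabulate (λ i → g (Fin.suc i)) l l<n

  insertSeq : ℕ → K → Seq → Seq
  insertSeq zero    a X zero    = a
  insertSeq zero    a X (suc k) = X k
  insertSeq (suc j) a X zero    = X zero
  insertSeq (suc j) a X (suc k) = insertSeq j a (λ t → X (suc t)) k

  insertTwice : ℕ → K → Seq → Seq
  insertTwice j a X = insertSeq (suc j) a (insertSeq j a X)

  mergeSeq : ℕ → Seq → Seq
  mergeSeq zero    X zero    = X 0 + X 1
  mergeSeq zero    X (suc k) = X (suc (suc k))
  mergeSeq (suc j) X zero    = X zero
  mergeSeq (suc j) X (suc k) = mergeSeq j (λ t → X (suc t)) k

  removeSeq : ℕ → Seq → Seq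
  removeSeq zero    X k       = X (suc k)
  removeSeq (suc j) X zero    = X zero
  removeSeq (suc j) X (suc k) = removeSeq j (λ t → X (suc t)) k

  toSeq-insertAt : ∀ {n} (v : Vec K n) (j : Fin (suc n)) a k →
    toSeq (Vec.insertAt v j a) k ≡ insertSeq (toℕ j) a (toSeq v) k
  toSeq-insertAt v       Fin.zero    a zero    = P.refl
  toSeq-insertAt v       Fin.zero    a (suc k) = P.refl
  toSeq-insertAt (x ∷ v) (Fin.suc j) a zero    = P.refl
  toSeq-insertAt (x ∷ v) (Fin.suc j) a (suc k) = toSeq-insertAt v j a k

  toSeq-mergeAt : ∀ {n} (j : Fin n) (v : Vec K (suc n)) k →
    toSeq (mergeAt j v) k ≡ mergeSeq (toℕ j) (toSeq v) k
  toSeq-mergeAt Fin.zero    (a ∷ b ∷ v) zero    = P.refl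
  toSeq-mergeAt Fin.zero    (a ∷ b ∷ v) (suc k) = P.refl
  toSeq-mergeAt (Fin.suc j) (a ∷ v)     zero    = P.refl
  toSeq-mergeAt (Fin.suc j) (a ∷ v)     (suc k) = toSeq-mergeAt j v k

  toSeq-removeAt : ∀ {n} (v : Vec K (suc n)) (j : Fin (suc n)) k →
    toSeq (Vec.removeAt v j) k ≡ removeSeq (toℕ j) (toSeq v) k
  toSeq-removeAt (x ∷ v)     Fin.zero    k       = P.refl
  toSeq-removeAt (x ∷ y ∷ v) (Fin.suc j) zero    = P.refl
  toSeq-removeAt (x ∷ y ∷ v) (Fin.suc j) (suc k) = toSeq-removeAt (y ∷ v) j k

  insertSeq-< : ∀ j a X k → k ℕ.< j → insertSeq j a X k ≡ X k
  insertSeq-< (suc j) a X zero    k<j       = P.refl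
  insertSeq-< (suc j) a X (suc k) (s≤s k<j) = insertSeq-< j a (λ t → X (suc t)) k k<j

  insertSeq-≡ : ∀ j a X → insertSeq j a X j ≡ a
  insertSeq-≡ zero    a X = P.refl
  insertSeq-≡ (suc j) a X = insertSeq-≡ j a (λ t → X (suc t))

  insertSeq-> : ∀ j a X k → j ℕ.≤ k → insertSeq j a X (suc k) ≡ X k
  insertSeq-> zero    a X k       j≤k       = P.refl
  insertSeq-> (suc j) a X (suc k) (s≤s j≤k) = insertSeq-> j a (λ t → X (suc t)) k j≤k

  mergeSeq-< : ∀ j X k → k ℕ.< j → mergeSeq j X k ≡ X k
  mergeSeq-< (suc j) X zero    k<j       = P.refl
  mergeSeq-< (suc j) X (suc k) (s≤s k<j) = mergeSeq-< j (λ t → X (suc t)) k k<j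

  removeSeq-< : ∀ j X k → k ℕ.< j → removeSeq j X k ≡ X k
  removeSeq-< (suc j) X zero    k<j       = P.refl
  removeSeq-< (suc j) X (suc k) (s≤s k<j) = removeSeq-< j (λ t → X (suc t)) k k<j

  toSeq-padZero : ∀ {n} (x : Vec K n) k → toSeq (Vec.insertAt x (Fin.fromℕ n) 0#) k ≡ toSeq x k
  toSeq-padZero {n} x k = P.trans (toSeq-insertAt x (Fin.fromℕ n) 0# k)
    (P.trans (cong (λ z → insertSeq z 0# (toSeq x) k) (FinP.toℕ-fromℕ n)) padding)
    where
    padding : insertSeq n 0# (toSeq x) k ≡ toSeq x k
    padding with ℕP.<-cmp k n
    ... | tri< k<n _ _       = insertSeq-< n 0# (toSeq x) k k<n
    ... | tri≈ _ P.refl _    = P.trans (insertSeq-≡ n 0# (toSeq x)) (P.sym (toSeq-beyond x n ℕP.≤-refl))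
    ... | tri> _ _ (s≤s n≤k) = P.trans (insertSeq-> n 0# (toSeq x) _ n≤k)
      (P.trans (toSeq-beyond x _ n≤k) (P.sym (toSeq-beyond x _ (ℕP.m≤n⇒m≤1+n n≤k))))

  insertTwice-before : ∀ j a X l → l ℕ.< j → insertTwice j a X l ≡ X l
  insertTwice-before j a X l l<j =
    P.trans (insertSeq-< (suc j) a (insertSeq j a X) l (ℕP.m<n⇒m<1+n l<j)) (insertSeq-< j a X l l<j)

  insertTwice-first : ∀ j a X → insertTwice j a X j ≡ a
  insertTwice-first j a X =
    P.trans (insertSeq-< (suc j) a (insertSeq j a X) j (ℕP.n<1+n j)) (insertSeq-≡ j a X)

  insertTwice-second : ∀ j a X → insertTwice j a X (suc j) ≡ a
  insertTwice-second j a X = insertSeq-≡ (suc j) a (insertSeq j a X)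

  insertTwice-after : ∀ j a X l → j ℕ.≤ l → insertTwice j a X (suc (suc l)) ≡ X l
  insertTwice-after j a X l j≤l =
    P.trans (insertSeq-> (suc j) a (insertSeq j a X) (suc l) (s≤s j≤l)) (insertSeq-> j a X l j≤l)

  infix 4 _≋[_]_
  _≋[_]_ : Seq → ℕ → Seq → Set
  X ≋[ n ] Y = ∀ k → k ℕ.< n → X k ≈ Y k

  ≋-refl : ∀ {X n} → X ≋[ n ] X
  ≋-refl _ _ = refl

  ≋-sym : ∀ {X Y n} → X ≋[ n ] Y → Y ≋[ n ] X
  ≋-sym X≋Y k k<n = sym (X≋Y k k<n)

  ≋-pointwise : ∀ {X Y n} → (∀ k → X k ≈ Y k) → X ≋[ n ] Y
  ≋-pointwise X≈Y k _ = X≈Y k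

  ≋-reflexive : ∀ {X Y n} → (∀ k → X k ≡ Y k) → X ≋[ n ] Y
  ≋-reflexive X≡Y k _ = reflexive (X≡Y k)

  toSeq-tabulateSeq : ∀ n X → toSeq (tabulateSeq n X) ≋[ n ] X
  toSeq-tabulateSeq (suc n) X zero    _         = refl
  toSeq-tabulateSeq (suc n) X (suc k) (s≤s k<n) = toSeq-tabulateSeq n (λ t → X (suc t)) k k<n

  insertSeq-cong : ∀ {X Y} j a → (∀ k → X k ≈ Y k) → ∀ k → insertSeq j a X k ≈ insertSeq j a Y k
  insertSeq-cong zero    a X≈Y zero    = refl
  insertSeq-cong zero    a X≈Y (suc k) = X≈Y k
  insertSeq-cong (suc j) a X≈Y zero    = X≈Y zero
  insertSeq-cong (suc j) a X≈Y (suc k) = insertSeq-cong j a (λ t → X≈Y (suc t)) k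

  insertSeq-cong-≋ : ∀ {X Y n} j a → j ℕ.≤ n → X ≋[ n ] Y →
    insertSeq j a X ≋[ suc n ] insertSeq j a Y
  insertSeq-cong-≋ zero a _ X≋Y zero    _ = refl
  insertSeq-cong-≋ zero a _ X≋Y (suc k) (s≤s k<n) = X≋Y k k<n
  insertSeq-cong-≋ {n = suc n} (suc j) a _ X≋Y zero _ = X≋Y zero z<s
  insertSeq-cong-≋ {n = suc n} (suc j) a (s≤s j≤n) X≋Y (suc k) (s≤s k<n) =
    insertSeq-cong-≋ j a j≤n (λ t t<n → X≋Y (suc t) (s≤s t<n)) k k<n

  mergeSeq-cong-≋ : ∀ {X Y n} j → X ≋[ suc n ] Y → mergeSeq j X ≋[ n ] mergeSeq j Y
  mergeSeq-cong-≋ zero X≋Y zero    k<n = +-cong (X≋Y 0 z<s) (X≋Y 1 (s<s k<n))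
  mergeSeq-cong-≋ zero X≋Y (suc k) k<n = X≋Y (suc (suc k)) (s<s k<n)
  mergeSeq-cong-≋ (suc j) X≋Y zero k<n = X≋Y zero z<s
  mergeSeq-cong-≋ {n = suc n} (suc j) X≋Y (suc k) (s≤s k<n) =
    mergeSeq-cong-≋ j (λ t t<n → X≋Y (suc t) (s≤s t<n)) k k<n

  removeSeq-cong-≋ : ∀ {X Y n} j → X ≋[ suc n ] Y → removeSeq j X ≋[ n ] removeSeq j Y
  removeSeq-cong-≋ zero X≋Y k k<n = X≋Y (suc k) (s<s k<n)
  removeSeq-cong-≋ (suc j) X≋Y zero k<n = X≋Y zero z<s
  removeSeq-cong-≋ {n = suc n} (suc j) X≋Y (suc k) (s≤s k<n) =
    removeSeq-cong-≋ j (λ t t<n → X≋Y (suc t) (s≤s t<n)) k k<n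

  evalSeqX : SeqX → ℕ → Seq → K
  evalSeqX f n X = eval (λ i → X (toℕ i)) (f n)

  evalSeqPQ : SeqPQ → ℕ → Seq → Seq → K
  evalSeqPQ h m P Q = eval [ (λ i → P (toℕ i)) , (λ i → Q (toℕ i)) ] (h m)

  evalSeqX-cong : ∀ f n {X Y} → X ≋[ n ] Y → evalSeqX f n X ≈ evalSeqX f n Y
  evalSeqX-cong f n X≋Y = eval-cong (λ i → X≋Y (toℕ i) (FinP.toℕ<n i)) (f n)

  evalSeqPQ-cong : ∀ h m {P P' Q Q'} → P ≋[ m ] P' → Q ≋[ m ] Q' →
    evalSeqPQ h m P Q ≈ evalSeqPQ h m P' Q'
  evalSeqPQ-cong h m P≋P' Q≋Q' = eval-cong
    (λ { (inj₁ i) → P≋P' (toℕ i) (FinP.toℕ<n i) ; (inj₂ i) → Q≋Q' (toℕ i) (FinP.toℕ<n i) }) (h m)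

  evalSeqPQ-congˡ : ∀ h m {P P'} Q → P ≋[ m ] P' → evalSeqPQ h m P Q ≈ evalSeqPQ h m P' Q
  evalSeqPQ-congˡ h m Q P≋P' = evalSeqPQ-cong h m {Q = Q} P≋P' ≋-refl

  evalSeqPQ-congʳ : ∀ h m P {Q Q'} → Q ≋[ m ] Q' → evalSeqPQ h m P Q ≈ evalSeqPQ h m P Q'
  evalSeqPQ-congʳ h m P Q≋Q' = evalSeqPQ-cong h m {P = P} ≋-refl Q≋Q'

  evalX≈evalSeqX : ∀ f {n} (x : Vec K n) → evalX f x ≈ evalSeqX f n (toSeq x)
  evalX≈evalSeqX f {n} x = eval-cong (λ i → reflexive (lookup≡toSeq x i)) (f n)

  evalPQ≈evalSeqPQ : ∀ h {m} (p q : Vec K m) → evalPQ h p q ≈ evalSeqPQ h m (toSeq p) (toSeq q)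
  evalPQ≈evalSeqPQ h {m} p q = eval-cong
    (λ { (inj₁ i) → reflexive (lookup≡toSeq p i) ; (inj₂ i) → reflexive (lookup≡toSeq q i) }) (h m)

  evalPQ≈evalSeqPQ-≋ : ∀ h {m} (p q : Vec K m) {P Q} → toSeq p ≋[ m ] P → toSeq q ≋[ m ] Q →
    evalPQ h p q ≈ evalSeqPQ h m P Q
  evalPQ≈evalSeqPQ-≋ h {m} p q p≋P q≋Q =
    trans (evalPQ≈evalSeqPQ h p q) (evalSeqPQ-cong h m p≋P q≋Q)

  evalX≈evalSeqX-≋ : ∀ f {n} (x : Vec K n) {X} → toSeq x ≋[ n ] X → evalX f x ≈ evalSeqX f n X
  evalX≈evalSeqX-≋ f {n} x x≋X = trans (evalX≈evalSeqX f x) (evalSeqX-cong f n x≋X)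

  toSeq-insertAt-tabulate : ∀ k (j : Fin (suc k)) a X →
    toSeq (Vec.insertAt (tabulateSeq k X) j a) ≋[ suc k ] insertSeq (toℕ j) a X
  toSeq-insertAt-tabulate k j a X t t<1+k = trans
    (reflexive (toSeq-insertAt (tabulateSeq k X) j a t))
    (insertSeq-cong-≋ (toℕ j) a (ℕP.≤-pred (FinP.toℕ<n j)) (toSeq-tabulateSeq k X) t t<1+k)

  toSeq-mergeAt-tabulate : ∀ k (j : Fin k) X →
    toSeq (mergeAt j (tabulateSeq (suc k) X)) ≋[ k ] mergeSeq (toℕ j) X
  toSeq-mergeAt-tabulate k j X t t<k = trans
    (reflexive (toSeq-mergeAt j (tabulateSeq (suc k) X) t))
    (mergeSeq-cong-≋ (toℕ j) (toSeq-tabulateSeq (suc k) X) t t<k)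

  toSeq-removeAt-tabulate : ∀ k (j : Fin (suc k)) X →
    toSeq (Vec.removeAt (tabulateSeq (suc k) X) j) ≋[ k ] removeSeq (toℕ j) X
  toSeq-removeAt-tabulate k j X t t<k = trans
    (reflexive (toSeq-removeAt (tabulateSeq (suc k) X) j t))
    (removeSeq-cong-≋ (toℕ j) (toSeq-tabulateSeq (suc k) X) t t<k)

  removeSeq≋mergeSeq : ∀ k X → removeSeq k X ≋[ k ] mergeSeq k X
  removeSeq≋mergeSeq k X t t<k =
    reflexive (P.trans (removeSeq-< k X t t<k) (P.sym (mergeSeq-< k X t t<k)))

  -- Conditions (Q), (P), stability and cancellation on sequences. In (Q)
  -- the case i = m is j = k: merging p_m with the absent p_{m+1} drops p_m.
  CondQˢ : SeqPQ → Set
  CondQˢ h = ∀ k j P Q → j ℕ.≤ k →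
    evalSeqPQ h (suc k) P (insertSeq j 0# Q) ≈ evalSeqPQ h k (mergeSeq j P) Q

  CondP-firstˢ : SeqPQ → Set
  CondP-firstˢ h = ∀ k P Q →
    evalSeqPQ h (suc k) (insertSeq 0 0# P) Q ≈ evalSeqPQ h k P (removeSeq 0 Q)

  CondP-laterˢ : SeqPQ → Set
  CondP-laterˢ h = ∀ k j P Q → j ℕ.< k →
    evalSeqPQ h (suc k) (insertSeq (suc j) 0# P) Q ≈ evalSeqPQ h k P (mergeSeq j Q)

  StablePQˢ : SeqPQ → Set
  StablePQˢ h = ∀ m P Q →
    evalSeqPQ h (suc m) (insertSeq m 0# P) (insertSeq m 0# Q) ≈ evalSeqPQ h m P Q

  CancelXˢ : SeqX → Set
  CancelXˢ f = ∀ k j a X Y → j ℕ.≤ k → X ≋[ suc (suc k) ] insertTwice j a Y →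
    evalSeqX f (suc (suc k)) X ≈ evalSeqX f k Y

  CondQ⇒CondQˢ : ∀ h → CondQ h → CondQˢ h
  CondQ⇒CondQˢ h (condQ-inner , condQ-last) k j P Q j≤k with ℕP.m≤n⇒m<n∨m≡n j≤k
  ... | inj₁ j<k = begin
    evalSeqPQ h (suc k) P (insertSeq j 0# Q) ≈⟨ sym (evalPQ≈evalSeqPQ-≋ h p q₀ p≋P q₀≋) ⟩
    evalPQ h p q₀                            ≈⟨ condQ-inner k i p q ⟩
    evalPQ h p₁ q                            ≈⟨ evalPQ≈evalSeqPQ-≋ h p₁ q p₁≋ (toSeq-tabulateSeq k Q) ⟩
    evalSeqPQ h k (mergeSeq j P) Q           ∎
    where
    p = tabulateSeq (suc k) P
    q = tabulateSeq k Q
    p≋P = toSeq-tabulateSeq (suc k) P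
    i = fromℕ< j<k
    q₀ = Vec.insertAt q (Fin.inject₁ i) 0#
    p₁ = mergeAt i p
    q₀≋ : toSeq q₀ ≋[ suc k ] insertSeq j 0# Q
    q₀≋ = P.subst (λ z → toSeq q₀ ≋[ suc k ] insertSeq z 0# Q)
                  (P.trans (FinP.toℕ-inject₁ i) (FinP.toℕ-fromℕ< j<k))
                  (toSeq-insertAt-tabulate k (Fin.inject₁ i) 0# Q)
    p₁≋ : toSeq p₁ ≋[ k ] mergeSeq j P
    p₁≋ = P.subst (λ z → toSeq p₁ ≋[ k ] mergeSeq z P) (FinP.toℕ-fromℕ< j<k)
                  (toSeq-mergeAt-tabulate k i P)
  ... | inj₂ P.refl = begin
    evalSeqPQ h (suc k) P (insertSeq k 0# Q) ≈⟨ sym (evalPQ≈evalSeqPQ-≋ h p q₀ p≋P q₀≋) ⟩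
    evalPQ h p q₀                            ≈⟨ condQ-last k p q ⟩
    evalPQ h p₁ q                            ≈⟨ evalPQ≈evalSeqPQ-≋ h p₁ q p₁≋ (toSeq-tabulateSeq k Q) ⟩
    evalSeqPQ h k (mergeSeq k P) Q           ∎
    where
    p = tabulateSeq (suc k) P
    q = tabulateSeq k Q
    p≋P = toSeq-tabulateSeq (suc k) P
    q₀ = Vec.insertAt q (Fin.fromℕ k) 0#
    p₁ = Vec.removeAt p (Fin.fromℕ k)
    q₀≋ : toSeq q₀ ≋[ suc k ] insertSeq k 0# Q
    q₀≋ = P.subst (λ z → toSeq q₀ ≋[ suc k ] insertSeq z 0# Q) (FinP.toℕ-fromℕ k)
                  (toSeq-insertAt-tabulate k (Fin.fromℕ k) 0# Q)
    p₁≋ : toSeq p₁ ≋[ k ] mergeSeq k P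
    p₁≋ t t<k = trans
      (P.subst (λ z → toSeq p₁ t ≈ removeSeq z P t) (FinP.toℕ-fromℕ k)
               (toSeq-removeAt-tabulate k (Fin.fromℕ k) P t t<k))
      (removeSeq≋mergeSeq k P t t<k)

  CondP⇒CondP-firstˢ : ∀ h → CondP h → CondP-firstˢ h
  CondP⇒CondP-firstˢ h (_ , condP-first) k P Q = begin
    evalSeqPQ h (suc k) (insertSeq 0 0# P) Q ≈⟨ sym (evalPQ≈evalSeqPQ-≋ h p₀ q p₀≋ q≋Q) ⟩
    evalPQ h p₀ q                            ≈⟨ condP-first k p q ⟩
    evalPQ h p q₁                            ≈⟨ evalPQ≈evalSeqPQ-≋ h p q₁ p≋P q₁≋ ⟩
    evalSeqPQ h k P (removeSeq 0 Q)          ∎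
    where
    p = tabulateSeq k P
    q = tabulateSeq (suc k) Q
    p₀ = Vec.insertAt p Fin.zero 0#
    q₁ = Vec.removeAt q Fin.zero
    p≋P = toSeq-tabulateSeq k P
    q≋Q = toSeq-tabulateSeq (suc k) Q
    p₀≋ = toSeq-insertAt-tabulate k Fin.zero 0# P
    q₁≋ = toSeq-removeAt-tabulate k Fin.zero Q

  CondP⇒CondP-laterˢ : ∀ h → CondP h → CondP-laterˢ h
  CondP⇒CondP-laterˢ h (condP-later , _) k j P Q j<k = begin
    evalSeqPQ h (suc k) (insertSeq (suc j) 0# P) Q ≈⟨ sym (evalPQ≈evalSeqPQ-≋ h p₀ q p₀≋ q≋Q) ⟩
    evalPQ h p₀ q                                  ≈⟨ condP-later k i p q ⟩
    evalPQ h p q₁                                  ≈⟨ evalPQ≈evalSeqPQ-≋ h p q₁ p≋P q₁≋ ⟩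
    evalSeqPQ h k P (mergeSeq j Q)                 ∎
    where
    p = tabulateSeq k P
    q = tabulateSeq (suc k) Q
    p≋P = toSeq-tabulateSeq k P
    q≋Q = toSeq-tabulateSeq (suc k) Q
    i = fromℕ< j<k
    p₀ = Vec.insertAt p (Fin.suc i) 0#
    q₁ = mergeAt i q
    p₀≋ : toSeq p₀ ≋[ suc k ] insertSeq (suc j) 0# P
    p₀≋ = P.subst (λ z → toSeq p₀ ≋[ suc k ] insertSeq (suc z) 0# P) (FinP.toℕ-fromℕ< j<k)
                  (toSeq-insertAt-tabulate k (Fin.suc i) 0# P)
    q₁≋ : toSeq q₁ ≋[ k ] mergeSeq j Q
    q₁≋ = P.subst (λ z → toSeq q₁ ≋[ k ] mergeSeq z Q) (FinP.toℕ-fromℕ< j<k)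
                  (toSeq-mergeAt-tabulate k i Q)

  CondQˢ⇒CondQ : ∀ h → CondQˢ h → CondQ h
  CondQˢ⇒CondQ h condQ = condQ-inner , condQ-last
    where
    condQ-inner : ∀ k (j : Fin k) (p : Vec K (suc k)) (q : Vec K k) →
      evalPQ h p (Vec.insertAt q (Fin.inject₁ j) 0#) ≈ evalPQ h (mergeAt j p) q
    condQ-inner k j p q = begin
      evalPQ h p q₀                                        ≈⟨ evalPQ≈evalSeqPQ-≋ h p q₀ ≋-refl q₀≋ ⟩
      evalSeqPQ h (suc k) (toSeq p) (insertSeq (toℕ j) 0# (toSeq q))
        ≈⟨ condQ k (toℕ j) (toSeq p) (toSeq q) (ℕP.<⇒≤ (FinP.toℕ<n j)) ⟩
      evalSeqPQ h k (mergeSeq (toℕ j) (toSeq p)) (toSeq q) ≈⟨ sym (evalPQ≈evalSeqPQ-≋ h p₁ q p₁≋ ≋-refl) ⟩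
      evalPQ h p₁ q                                        ∎
      where
      q₀ = Vec.insertAt q (Fin.inject₁ j) 0#
      p₁ = mergeAt j p
      q₀≋ : toSeq q₀ ≋[ suc k ] insertSeq (toℕ j) 0# (toSeq q)
      q₀≋ = ≋-reflexive λ t → P.trans (toSeq-insertAt q (Fin.inject₁ j) 0# t)
                                     (cong (λ z → insertSeq z 0# (toSeq q) t) (FinP.toℕ-inject₁ j))
      p₁≋ = ≋-reflexive (toSeq-mergeAt j p)
    condQ-last : ∀ k (p : Vec K (suc k)) (q : Vec K k) →
      evalPQ h p (Vec.insertAt q (Fin.fromℕ k) 0#) ≈ evalPQ h (Vec.removeAt p (Fin.fromℕ k)) q
    condQ-last k p q = begin
      evalPQ h p q₀                                  ≈⟨ evalPQ≈evalSeqPQ-≋ h p q₀ ≋-refl q₀≋ ⟩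
      evalSeqPQ h (suc k) (toSeq p) (insertSeq k 0# (toSeq q))
        ≈⟨ condQ k k (toSeq p) (toSeq q) ℕP.≤-refl ⟩
      evalSeqPQ h k (mergeSeq k (toSeq p)) (toSeq q) ≈⟨ sym (evalPQ≈evalSeqPQ-≋ h p₁ q p₁≋ ≋-refl) ⟩
      evalPQ h p₁ q                                  ∎
      where
      q₀ = Vec.insertAt q (Fin.fromℕ k) 0#
      p₁ = Vec.removeAt p (Fin.fromℕ k)
      q₀≋ : toSeq q₀ ≋[ suc k ] insertSeq k 0# (toSeq q)
      q₀≋ = ≋-reflexive λ t → P.trans (toSeq-insertAt q (Fin.fromℕ k) 0# t)
                                     (cong (λ z → insertSeq z 0# (toSeq q) t) (FinP.toℕ-fromℕ k))
      p₁≋ : toSeq p₁ ≋[ k ] mergeSeq k (toSeq p)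
      p₁≋ t t<k = trans
        (reflexive (P.trans (toSeq-removeAt p (Fin.fromℕ k) t)
                            (cong (λ z → removeSeq z (toSeq p) t) (FinP.toℕ-fromℕ k))))
        (removeSeq≋mergeSeq k (toSeq p) t t<k)

  CondPˢ⇒CondP : ∀ h → CondP-firstˢ h → CondP-laterˢ h → CondP h
  CondPˢ⇒CondP h condP-first condP-later = condP-later′ , condP-first′
    where
    condP-later′ : ∀ k (j : Fin k) (p : Vec K k) (q : Vec K (suc k)) →
      evalPQ h (Vec.insertAt p (Fin.suc j) 0#) q ≈ evalPQ h p (mergeAt j q)
    condP-later′ k j p q = begin
      evalPQ h p₀ q                                        ≈⟨ evalPQ≈evalSeqPQ-≋ h p₀ q p₀≋ ≋-refl ⟩
      evalSeqPQ h (suc k) (insertSeq (suc (toℕ j)) 0# (toSeq p)) (toSeq q)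
        ≈⟨ condP-later k (toℕ j) (toSeq p) (toSeq q) (FinP.toℕ<n j) ⟩
      evalSeqPQ h k (toSeq p) (mergeSeq (toℕ j) (toSeq q)) ≈⟨ sym (evalPQ≈evalSeqPQ-≋ h p q₁ ≋-refl q₁≋) ⟩
      evalPQ h p q₁                                        ∎
      where
      p₀ = Vec.insertAt p (Fin.suc j) 0#
      q₁ = mergeAt j q
      p₀≋ = ≋-reflexive (toSeq-insertAt p (Fin.suc j) 0#)
      q₁≋ = ≋-reflexive (toSeq-mergeAt j q)
    condP-first′ : ∀ k (p : Vec K k) (q : Vec K (suc k)) →
      evalPQ h (Vec.insertAt p Fin.zero 0#) q ≈ evalPQ h p (Vec.removeAt q Fin.zero)
    condP-first′ k p q = begin
      evalPQ h p₀ q                                   ≈⟨ evalPQ≈evalSeqPQ-≋ h p₀ q p₀≋ ≋-refl ⟩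
      evalSeqPQ h (suc k) (insertSeq 0 0# (toSeq p)) (toSeq q)
        ≈⟨ condP-first k (toSeq p) (toSeq q) ⟩
      evalSeqPQ h k (toSeq p) (removeSeq 0 (toSeq q)) ≈⟨ sym (evalPQ≈evalSeqPQ-≋ h p q₁ ≋-refl q₁≋) ⟩
      evalPQ h p q₁                                   ∎
      where
      p₀ = Vec.insertAt p Fin.zero 0#
      q₁ = Vec.removeAt q Fin.zero
      p₀≋ = ≋-reflexive (toSeq-insertAt p Fin.zero 0#)
      q₁≋ = ≋-reflexive (toSeq-removeAt q Fin.zero)

  StablePQˢ⇒StablePQ : ∀ h → StablePQˢ h → StablePQ h
  StablePQˢ⇒StablePQ h stable m p q = begin
    evalPQ h (padded p) (padded q)
      ≈⟨ evalPQ≈evalSeqPQ-≋ h (padded p) (padded q) (padded≋ p) (padded≋ q) ⟩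
    evalSeqPQ h (suc m) (insertSeq m 0# (toSeq p)) (insertSeq m 0# (toSeq q))
      ≈⟨ stable m (toSeq p) (toSeq q) ⟩
    evalSeqPQ h m (toSeq p) (toSeq q)
      ≈⟨ sym (evalPQ≈evalSeqPQ h p q) ⟩
    evalPQ h p q ∎
    where
    padded : Vec K m → Vec K (suc m)
    padded v = Vec.insertAt v (Fin.fromℕ m) 0#
    padded≋ : ∀ v → toSeq (padded v) ≋[ suc m ] insertSeq m 0# (toSeq v)
    padded≋ v = ≋-reflexive λ t → P.trans (toSeq-insertAt v (Fin.fromℕ m) 0# t)
                                         (cong (λ z → insertSeq z 0# (toSeq v) t) (FinP.toℕ-fromℕ m))

  CancelX⇒CancelXˢ : ∀ f → CancelX f → CancelXˢ f
  CancelX⇒CancelXˢ f cancel k j a X Y j≤k X≋ = begin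
    evalSeqX f (suc (suc k)) X ≈⟨ sym (evalX≈evalSeqX-≋ f x x≋X) ⟩
    evalX f x                  ≈⟨ cancel k y i a ⟩
    evalX f y                  ≈⟨ evalX≈evalSeqX-≋ f y (toSeq-tabulateSeq k Y) ⟩
    evalSeqX f k Y             ∎
    where
    y = tabulateSeq k Y
    i = fromℕ< (s≤s j≤k)
    x = Vec.insertAt (Vec.insertAt y i a) (Fin.suc i) a
    x≋X : toSeq x ≋[ suc (suc k) ] X
    x≋X t t<2+k = begin
      toSeq x t
        ≡⟨ toSeq-insertAt (Vec.insertAt y i a) (Fin.suc i) a t ⟩
      insertSeq (suc (toℕ i)) a (toSeq (Vec.insertAt y i a)) t
        ≈⟨ insertSeq-cong (suc (toℕ i)) a (λ s → reflexive (toSeq-insertAt y i a s)) t ⟩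
      insertTwice (toℕ i) a (toSeq y) t
        ≡⟨ cong (λ z → insertTwice z a (toSeq y) t) (FinP.toℕ-fromℕ< (s≤s j≤k)) ⟩
      insertTwice j a (toSeq y) t
        ≈⟨ insertSeq-cong-≋ (suc j) a (s≤s j≤k)
             (insertSeq-cong-≋ j a j≤k (toSeq-tabulateSeq k Y)) t t<2+k ⟩
      insertTwice j a Y t
        ≈⟨ sym (X≋ t t<2+k) ⟩
      X t ∎

  pCoord qCoord : Seq → Seq
  pCoord X j = X (double j) - X (suc (double j))
  qCoord X j = X (suc (double j)) - X (suc (suc (double j)))

  coords-cong : ∀ h {X Y} → (∀ k → X k ≈ Y k) → ∀ m →
    evalSeqPQ h m (pCoord X) (qCoord X) ≈ evalSeqPQ h m (pCoord Y) (qCoord Y)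
  coords-cong h X≈Y m = evalSeqPQ-cong h m
    (≋-pointwise λ j → +-cong (X≈Y (double j)) (-‿cong (X≈Y (suc (double j)))))
    (≋-pointwise λ j → +-cong (X≈Y (suc (double j))) (-‿cong (X≈Y (suc (suc (double j))))))

  eval-xvar : ∀ {n} (x : Vec K n) k → eval (lookup x) (xvar n k) ≡ toSeq x k
  eval-xvar {n} x k with k <? n
  ... | yes k<n = P.trans (lookup≡toSeq x _) (cong (toSeq x) (FinP.toℕ-fromℕ< k<n))
  ... | no k≮n  = P.sym (toSeq-beyond x k (ℕP.≮⇒≥ k≮n))

  deg-xvar : ∀ n k → deg (xvar n k) ℕ.≤ 1
  deg-xvar n k with k <? n
  ... | yes _ = s≤s z≤n
  ... | no _  = z≤n

  deg-Φσ : ∀ n m v → deg (Φσ n m v) ℕ.≤ 1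
  deg-Φσ n m (inj₁ j) = ℕP.⊔-lub (deg-xvar n _) (deg-xvar n _)
  deg-Φσ n m (inj₂ j) = ℕP.⊔-lub (deg-xvar n _) (deg-xvar n _)

  evalX-Φ : ∀ h {n} (x : Vec K n) →
    evalX (Φpq→x h) x ≈ evalSeqPQ h ⌊ n /2⌋ (pCoord (toSeq x)) (qCoord (toSeq x))
  evalX-Φ h {n} x = begin
    eval (lookup x) (subst (Φσ n m) (h m))         ≡⟨ eval-subst (lookup x) (Φσ n m) (h m) ⟩
    eval (λ v → eval (lookup x) (Φσ n m v)) (h m)  ≈⟨ eval-cong Φσ-value (h m) ⟩
    evalSeqPQ h m (pCoord (toSeq x)) (qCoord (toSeq x)) ∎
    where
    m = ⌊ n /2⌋
    eval-xvar-2j : ∀ j c → eval (lookup x) (xvar n (c ℕ.+ 2 ℕ.* j)) ≡ toSeq x (c ℕ.+ double j)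
    eval-xvar-2j j c = P.trans (eval-xvar x _) (cong (λ z → toSeq x (c ℕ.+ z)) (2*n≡double j))
    Φσ-value : ∀ v → eval (lookup x) (Φσ n m v)
                     ≈ [ (λ i → pCoord (toSeq x) (toℕ i)) , (λ i → qCoord (toSeq x) (toℕ i)) ] v
    Φσ-value (inj₁ j) = trans (eval-⊖ (lookup x) (xvar n _) (xvar n _))
      (reflexive (cong₂ _-_ (eval-xvar-2j (toℕ j) 0) (eval-xvar-2j (toℕ j) 1)))
    Φσ-value (inj₂ j) = trans (eval-⊖ (lookup x) (xvar n _) (xvar n _))
      (reflexive (cong₂ _-_ (eval-xvar-2j (toℕ j) 1) (eval-xvar-2j (toℕ j) 2)))

  -- Inserting a, a as x_{2i+1}, x_{2i+2} creates p_{i+1} = 0 between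
  -- q_i = x_{2i} - a and q_{i+1} = a - x_{2i+3}, whose sum is the old q_i;
  -- one position later the same happens with p and q exchanged.
  pCoord-insertTwice-even : ∀ i a Y l →
    pCoord (insertTwice (double i) a Y) l ≈ insertSeq i 0# (pCoord Y) l
  pCoord-insertTwice-even zero    a Y zero    = -‿inverseʳ a
  pCoord-insertTwice-even zero    a Y (suc l) = refl
  pCoord-insertTwice-even (suc i) a Y zero    = refl
  pCoord-insertTwice-even (suc i) a Y (suc l) =
    pCoord-insertTwice-even i a (λ t → Y (suc (suc t))) l

  qCoord-merge-insertTwice-even : ∀ i a Y l →
    mergeSeq i (qCoord (insertTwice (double (suc i)) a Y)) l ≈ qCoord Y l
  qCoord-merge-insertTwice-even zero a Y zero =
    solve 3 (λ y₁ a y₂ → (y₁ :- a) :+ (a :- y₂) := y₁ :- y₂) refl (Y 1) a (Y 2)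
  qCoord-merge-insertTwice-even zero    a Y (suc l) = refl
  qCoord-merge-insertTwice-even (suc i) a Y zero    = refl
  qCoord-merge-insertTwice-even (suc i) a Y (suc l) =
    qCoord-merge-insertTwice-even i a (λ t → Y (suc (suc t))) l

  qCoord-insertTwice-odd : ∀ i a Y l →
    qCoord (insertTwice (suc (double i)) a Y) l ≈ insertSeq i 0# (qCoord Y) l
  qCoord-insertTwice-odd zero    a Y zero    = -‿inverseʳ a
  qCoord-insertTwice-odd zero    a Y (suc l) = refl
  qCoord-insertTwice-odd (suc i) a Y zero    = refl
  qCoord-insertTwice-odd (suc i) a Y (suc l) =
    qCoord-insertTwice-odd i a (λ t → Y (suc (suc t))) l

  pCoord-merge-insertTwice-odd : ∀ i a Y l →
    mergeSeq i (pCoord (insertTwice (suc (double i)) a Y)) l ≈ pCoord Y l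
  pCoord-merge-insertTwice-odd zero a Y zero =
    solve 3 (λ y₀ a y₁ → (y₀ :- a) :+ (a :- y₁) := y₀ :- y₁) refl (Y 0) a (Y 1)
  pCoord-merge-insertTwice-odd zero    a Y (suc l) = refl
  pCoord-merge-insertTwice-odd (suc i) a Y zero    = refl
  pCoord-merge-insertTwice-odd (suc i) a Y (suc l) =
    pCoord-merge-insertTwice-odd i a (λ t → Y (suc (suc t))) l

  module _ (h : SeqPQ) (condQ : CondQˢ h) (condP-first : CondP-firstˢ h)
           (condP-later : CondP-laterˢ h) where

    coords-insertTwice : ∀ k j a Y → j ℕ.≤ k →
      evalSeqPQ h (suc ⌊ k /2⌋) (pCoord (insertTwice j a Y)) (qCoord (insertTwice j a Y))
        ≈ evalSeqPQ h ⌊ k /2⌋ (pCoord Y) (qCoord Y)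
    coords-insertTwice k j a Y j≤k with parity j
    ... | even zero = begin
      evalSeqPQ h (suc m) (pCoord X) (qCoord X)
        ≈⟨ evalSeqPQ-congˡ h (suc m) (qCoord X) (≋-pointwise (pCoord-insertTwice-even 0 a Y)) ⟩
      evalSeqPQ h (suc m) (insertSeq 0 0# (pCoord Y)) (qCoord X)
        ≈⟨ condP-first m (pCoord Y) (qCoord X) ⟩
      evalSeqPQ h m (pCoord Y) (qCoord Y) ∎
      where
      m = ⌊ k /2⌋
      X = insertTwice 0 a Y
    ... | even (suc i) = begin
      evalSeqPQ h (suc m) (pCoord X) (qCoord X)
        ≈⟨ evalSeqPQ-congˡ h (suc m) (qCoord X) (≋-pointwise (pCoord-insertTwice-even (suc i) a Y)) ⟩
      evalSeqPQ h (suc m) (insertSeq (suc i) 0# (pCoord Y)) (qCoord X)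
        ≈⟨ condP-later m i (pCoord Y) (qCoord X) i<m ⟩
      evalSeqPQ h m (pCoord Y) (mergeSeq i (qCoord X))
        ≈⟨ evalSeqPQ-congʳ h m (pCoord Y) (≋-pointwise (qCoord-merge-insertTwice-even i a Y)) ⟩
      evalSeqPQ h m (pCoord Y) (qCoord Y) ∎
      where
      m = ⌊ k /2⌋
      X = insertTwice (double (suc i)) a Y
      i<m : i ℕ.< m
      i<m = half-mono-≡ʳ j≤k (half-double (suc i))
    ... | odd i = begin
      evalSeqPQ h (suc m) (pCoord X) (qCoord X)
        ≈⟨ evalSeqPQ-congʳ h (suc m) (pCoord X) (≋-pointwise (qCoord-insertTwice-odd i a Y)) ⟩
      evalSeqPQ h (suc m) (pCoord X) (insertSeq i 0# (qCoord Y))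
        ≈⟨ condQ m i (pCoord X) (qCoord Y) i≤m ⟩
      evalSeqPQ h m (mergeSeq i (pCoord X)) (qCoord Y)
        ≈⟨ evalSeqPQ-congˡ h m (qCoord Y) (≋-pointwise (pCoord-merge-insertTwice-odd i a Y)) ⟩
      evalSeqPQ h m (pCoord Y) (qCoord Y) ∎
      where
      m = ⌊ k /2⌋
      X = insertTwice (suc (double i)) a Y
      i≤m : i ℕ.≤ m
      i≤m = half-mono-≡ʳ j≤k (half-suc-double i)

    -- For odd n = 2m + 1 the coordinates of x_1, …, x_n, 0 are those of
    -- x_1, …, x_n with p_{m+1} = x_n, q_{m+1} = 0 appended, and (Q) removes them.
    coords-drop-zero-pair : ∀ {n} (x : Vec K n) m → n ≡ suc (double m) →
      evalSeqPQ h (suc m) (pCoord (toSeq x)) (qCoord (toSeq x))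
        ≈ evalSeqPQ h m (pCoord (toSeq x)) (qCoord (toSeq x))
    coords-drop-zero-pair x m n≡1+2m = begin
      evalSeqPQ h (suc m) (pCoord X) (qCoord X)
        ≈⟨ evalSeqPQ-congʳ h (suc m) (pCoord X) last-q≈0 ⟩
      evalSeqPQ h (suc m) (pCoord X) (insertSeq m 0# (qCoord X))
        ≈⟨ condQ m m (pCoord X) (qCoord X) ℕP.≤-refl ⟩
      evalSeqPQ h m (mergeSeq m (pCoord X)) (qCoord X)
        ≈⟨ evalSeqPQ-congˡ h m (qCoord X) (λ t t<m → reflexive (mergeSeq-< m (pCoord X) t t<m)) ⟩
      evalSeqPQ h m (pCoord X) (qCoord X) ∎
      where
      X = toSeq x
      last-q≈0 : qCoord X ≋[ suc m ] insertSeq m 0# (qCoord X)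
      last-q≈0 t (s≤s t≤m) with ℕP.m≤n⇒m<n∨m≡n t≤m
      ... | inj₁ t<m = reflexive (P.sym (insertSeq-< m 0# (qCoord X) t t<m))
      ... | inj₂ P.refl = begin
        X (suc (double m)) - X (suc (suc (double m)))
          ≡⟨ cong₂ _-_ (toSeq-beyond x _ (ℕP.≤-reflexive n≡1+2m))
                       (toSeq-beyond x _ (ℕP.m≤n⇒m≤1+n (ℕP.≤-reflexive n≡1+2m))) ⟩
        0# - 0#                      ≈⟨ -‿inverseʳ 0# ⟩
        0#                           ≡⟨ P.sym (insertSeq-≡ m 0# (qCoord X)) ⟩
        insertSeq m 0# (qCoord X) m  ∎

    Φ-stable : StableX (Φpq→x h)
    Φ-stable n x = begin
      evalX (Φpq→x h) x'
        ≈⟨ evalX-Φ h x' ⟩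
      evalSeqPQ h ⌊ suc n /2⌋ (pCoord (toSeq x')) (qCoord (toSeq x'))
        ≈⟨ coords-cong h (λ k → reflexive (toSeq-padZero x k)) ⌊ suc n /2⌋ ⟩
      evalSeqPQ h ⌊ suc n /2⌋ (pCoord X) (qCoord X)
        ≈⟨ halves (half-suc n) ⟩
      evalSeqPQ h ⌊ n /2⌋ (pCoord X) (qCoord X)
        ≈⟨ sym (evalX-Φ h x) ⟩
      evalX (Φpq→x h) x ∎
      where
      x' = Vec.insertAt x (Fin.fromℕ n) 0#
      X = toSeq x
      halves : ⌊ suc n /2⌋ ≡ ⌊ n /2⌋ ⊎ (⌊ suc n /2⌋ ≡ suc ⌊ n /2⌋ × n ≡ suc (double ⌊ n /2⌋)) →
        evalSeqPQ h ⌊ suc n /2⌋ (pCoord X) (qCoord X) ≈ evalSeqPQ h ⌊ n /2⌋ (pCoord X) (qCoord X)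
      halves (inj₁ same) = reflexive (cong (λ z → evalSeqPQ h z (pCoord X) (qCoord X)) same)
      halves (inj₂ (next , n-odd)) = trans
        (reflexive (cong (λ z → evalSeqPQ h z (pCoord X) (qCoord X)) next))
        (coords-drop-zero-pair x ⌊ n /2⌋ n-odd)

    Φ-cancel : CancelX (Φpq→x h)
    Φ-cancel k y j a = begin
      evalX (Φpq→x h) x
        ≈⟨ evalX-Φ h x ⟩
      evalSeqPQ h (suc ⌊ k /2⌋) (pCoord (toSeq x)) (qCoord (toSeq x))
        ≈⟨ coords-cong h x≈ (suc ⌊ k /2⌋) ⟩
      evalSeqPQ h (suc ⌊ k /2⌋) (pCoord (insertTwice (toℕ j) a Y)) (qCoord (insertTwice (toℕ j) a Y))
        ≈⟨ coords-insertTwice k (toℕ j) a Y (ℕP.≤-pred (FinP.toℕ<n j)) ⟩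
      evalSeqPQ h ⌊ k /2⌋ (pCoord Y) (qCoord Y)
        ≈⟨ sym (evalX-Φ h y) ⟩
      evalX (Φpq→x h) y ∎
      where
      x = Vec.insertAt (Vec.insertAt y j a) (Fin.suc j) a
      Y = toSeq y
      x≈ : ∀ t → toSeq x t ≈ insertTwice (toℕ j) a Y t
      x≈ t = trans (reflexive (toSeq-insertAt (Vec.insertAt y j a) (Fin.suc j) a t))
                   (insertSeq-cong (suc (toℕ j)) a (λ s → reflexive (toSeq-insertAt y j a s)) t)

  Φ-preserves-Sol : ∀ h → IsSol' h → IsSol (Φpq→x h)
  Φ-preserves-Sol h ((d , h-deg) , _ , condQ , condP) =
    (d , λ n → HasDegree≤-subst-linear (Φσ n ⌊ n /2⌋) (deg-Φσ n ⌊ n /2⌋) {h ⌊ n /2⌋} (h-deg ⌊ n /2⌋)) ,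
    Φ-stable h condQˢ condP-firstˢ condP-laterˢ ,
    Φ-cancel h condQˢ condP-firstˢ condP-laterˢ
    where
    condQˢ = CondQ⇒CondQˢ h condQ
    condP-firstˢ = CondP⇒CondP-firstˢ h condP
    condP-laterˢ = CondP⇒CondP-laterˢ h condP

  open PartialSums _+_ 0#

  total-cong-≋ : ∀ m {X Y} → X ≋[ m ] Y → total m X ≈ total m Y
  total-cong-≋ zero    X≋Y = refl
  total-cong-≋ (suc m) X≋Y = +-cong (X≋Y 0 z<s) (total-cong-≋ m (λ t t<m → X≋Y (suc t) (s<s t<m)))

  suffixSum-cong-≋ : ∀ m i {X Y} → X ≋[ m ] Y → suffixSum m X i ≈ suffixSum m Y i
  suffixSum-cong-≋ m       zero    X≋Y = total-cong-≋ m X≋Y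
  suffixSum-cong-≋ zero    (suc i) X≋Y = refl
  suffixSum-cong-≋ (suc m) (suc i) X≋Y = suffixSum-cong-≋ m i (λ t t<m → X≋Y (suc t) (s<s t<m))

  prefixSum-cong-≋ : ∀ i {X Y} → X ≋[ i ] Y → prefixSum X i ≈ prefixSum Y i
  prefixSum-cong-≋ zero    X≋Y = refl
  prefixSum-cong-≋ (suc i) X≋Y =
    +-cong (X≋Y 0 z<s) (prefixSum-cong-≋ i (λ t t<i → X≋Y (suc t) (s<s t<i)))

  total-insertSeq : ∀ j k X → j ℕ.≤ k → total (suc k) (insertSeq j 0# X) ≈ total k X
  total-insertSeq zero    k       X _         = +-identityˡ _
  total-insertSeq (suc j) (suc k) X (s≤s j≤k) = +-congˡ (total-insertSeq j k (λ t → X (suc t)) j≤k)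

  suffixSum-insertSeq-≤ : ∀ i j k X → i ℕ.≤ j → j ℕ.≤ k →
    suffixSum (suc k) (insertSeq j 0# X) i ≈ suffixSum k X i
  suffixSum-insertSeq-≤ zero    j       k       X _         j≤k = total-insertSeq j k X j≤k
  suffixSum-insertSeq-≤ (suc i) (suc j) (suc k) X (s≤s i≤j) (s≤s j≤k) =
    suffixSum-insertSeq-≤ i j k (λ t → X (suc t)) i≤j j≤k

  suffixSum-insertSeq-≥ : ∀ j i k X → j ℕ.≤ i →
    suffixSum (suc k) (insertSeq j 0# X) (suc i) ≈ suffixSum k X i
  suffixSum-insertSeq-≥ zero    i       k       X _ = refl
  suffixSum-insertSeq-≥ (suc j) (suc i) zero    X _ = refl
  suffixSum-insertSeq-≥ (suc j) (suc i) (suc k) X (s≤s j≤i) =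
    suffixSum-insertSeq-≥ j i k (λ t → X (suc t)) j≤i

  total-mergeSeq : ∀ j k X → j ℕ.< k → total k (mergeSeq j X) ≈ total (suc k) X
  total-mergeSeq zero    (suc k) X _         = +-assoc _ _ _
  total-mergeSeq (suc j) (suc k) X (s≤s j<k) = +-congˡ (total-mergeSeq j k (λ t → X (suc t)) j<k)

  suffixSum-mergeSeq-≤ : ∀ i j k X → i ℕ.≤ j → j ℕ.< k →
    suffixSum k (mergeSeq j X) i ≈ suffixSum (suc k) X i
  suffixSum-mergeSeq-≤ zero    j       k       X _         j<k = total-mergeSeq j k X j<k
  suffixSum-mergeSeq-≤ (suc i) (suc j) (suc k) X (s≤s i≤j) (s≤s j<k) =
    suffixSum-mergeSeq-≤ i j k (λ t → X (suc t)) i≤j j<k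

  suffixSum-mergeSeq-> : ∀ j i k X → j ℕ.< i →
    suffixSum k (mergeSeq j X) i ≈ suffixSum (suc k) X (suc i)
  suffixSum-mergeSeq-> zero    (suc i) zero    X _ = refl
  suffixSum-mergeSeq-> zero    (suc i) (suc k) X _ = refl
  suffixSum-mergeSeq-> (suc j) (suc i) zero    X _ = refl
  suffixSum-mergeSeq-> (suc j) (suc i) (suc k) X (s≤s j<i) =
    suffixSum-mergeSeq-> j i k (λ t → X (suc t)) j<i

  suffixSum-end : ∀ m X → suffixSum m X m ≈ 0#
  suffixSum-end zero    X = refl
  suffixSum-end (suc m) X = suffixSum-end m (λ t → X (suc t))

  suffixSum-step : ∀ t m X → t ℕ.< m → suffixSum m X t ≈ X t + suffixSum m X (suc t)
  suffixSum-step zero    (suc m) X _         = refl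
  suffixSum-step (suc t) (suc m) X (s≤s t<m) = suffixSum-step t m (λ s → X (suc s)) t<m

  prefixSum-insertSeq-≤ : ∀ i j a X → i ℕ.≤ j → prefixSum (insertSeq j a X) i ≈ prefixSum X i
  prefixSum-insertSeq-≤ zero    j       a X _         = refl
  prefixSum-insertSeq-≤ (suc i) (suc j) a X (s≤s i≤j) =
    +-congˡ (prefixSum-insertSeq-≤ i j a (λ t → X (suc t)) i≤j)

  prefixSum-insertSeq-≥ : ∀ j i X → j ℕ.≤ i → prefixSum (insertSeq j 0# X) (suc i) ≈ prefixSum X i
  prefixSum-insertSeq-≥ zero    i       X _         = +-identityˡ _
  prefixSum-insertSeq-≥ (suc j) (suc i) X (s≤s j≤i) =
    +-congˡ (prefixSum-insertSeq-≥ j i (λ t → X (suc t)) j≤i)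

  prefixSum-mergeSeq-≤ : ∀ i j X → i ℕ.≤ j → prefixSum (mergeSeq j X) i ≈ prefixSum X i
  prefixSum-mergeSeq-≤ zero    j       X _         = refl
  prefixSum-mergeSeq-≤ (suc i) (suc j) X (s≤s i≤j) =
    +-congˡ (prefixSum-mergeSeq-≤ i j (λ t → X (suc t)) i≤j)

  prefixSum-mergeSeq-> : ∀ j i X → j ℕ.< i → prefixSum (mergeSeq j X) i ≈ prefixSum X (suc i)
  prefixSum-mergeSeq-> zero    (suc i) X _         = +-assoc _ _ _
  prefixSum-mergeSeq-> (suc j) (suc i) X (s≤s j<i) =
    +-congˡ (prefixSum-mergeSeq-> j i (λ t → X (suc t)) j<i)

  prefixSum-suc : ∀ t X → prefixSum X (suc t) ≈ prefixSum X t + X t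
  prefixSum-suc zero    X = trans (+-identityʳ _) (sym (+-identityˡ _))
  prefixSum-suc (suc t) X = trans (+-congˡ (prefixSum-suc t (λ s → X (suc s)))) (sym (+-assoc _ _ _))

  prefixSum-zeros : ∀ i → prefixSum (λ _ → 0#) i ≈ 0#
  prefixSum-zeros zero    = refl
  prefixSum-zeros (suc i) = trans (+-identityˡ _) (prefixSum-zeros i)

  -- x_{l+1} in terms of p_{j+1} = P j and q_{j+1} = Q j
  interlacing : ℕ → Seq → Seq → Seq
  interlacing m P Q l = suffixSum m Q ⌊ l /2⌋ - prefixSum P ⌊ suc l /2⌋

  interlacing-even : ∀ m P Q t → interlacing m P Q (double t) ≡ suffixSum m Q t - prefixSum P t
  interlacing-even m P Q t =
    cong₂ (λ i i' → suffixSum m Q i - prefixSum P i') (half-double t) (half-suc-double t)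

  interlacing-odd : ∀ m P Q t →
    interlacing m P Q (suc (double t)) ≡ suffixSum m Q t - prefixSum P (suc t)
  interlacing-odd m P Q t =
    cong₂ (λ i i' → suffixSum m Q i - prefixSum P i') (half-suc-double t) (cong suc (half-double t))

  pCoord-interlacing : ∀ m P Q t → pCoord (interlacing m P Q) t ≈ P t
  pCoord-interlacing m P Q t = begin
    interlacing m P Q (double t) - interlacing m P Q (suc (double t))
      ≡⟨ cong₂ _-_ (interlacing-even m P Q t) (interlacing-odd m P Q t) ⟩
    (suffixSum m Q t - prefixSum P t) - (suffixSum m Q t - prefixSum P (suc t))
      ≈⟨ +-congˡ (-‿cong (+-congˡ (-‿cong (prefixSum-suc t P)))) ⟩
    (suffixSum m Q t - prefixSum P t) - (suffixSum m Q t - (prefixSum P t + P t))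
      ≈⟨ solve 3 (λ a b x → (a :- b) :- (a :- (b :+ x)) := x) refl (suffixSum m Q t) (prefixSum P t) (P t) ⟩
    P t ∎

  qCoord-interlacing : ∀ m P Q t → t ℕ.< m → qCoord (interlacing m P Q) t ≈ Q t
  qCoord-interlacing m P Q t t<m = begin
    interlacing m P Q (suc (double t)) - interlacing m P Q (suc (suc (double t)))
      ≡⟨ cong₂ _-_ (interlacing-odd m P Q t) (interlacing-even m P Q (suc t)) ⟩
    (suffixSum m Q t - prefixSum P (suc t)) - (suffixSum m Q (suc t) - prefixSum P (suc t))
      ≈⟨ +-congʳ (+-congʳ (suffixSum-step t m Q t<m)) ⟩
    ((Q t + suffixSum m Q (suc t)) - prefixSum P (suc t)) - (suffixSum m Q (suc t) - prefixSum P (suc t))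
      ≈⟨ solve 3 (λ x a c → ((x :+ a) :- c) :- (a :- c) := x)
               refl (Q t) (suffixSum m Q (suc t)) (prefixSum P (suc t)) ⟩
    Q t ∎

  -- Each condition of Sol' at (P, Q) amounts to the cancellation of a pair of
  -- equal interlacing coordinates, inserted where the zero p or q sits.
  evalX-interlacing : SeqX → ℕ → Seq → Seq → K
  evalX-interlacing f m P Q = evalSeqX f (suc (double m)) (interlacing m P Q)

  module _ (f : SeqX) (cancel : CancelXˢ f) where

    evalX-interlacing-stable : ∀ m P Q →
      evalX-interlacing f (suc m) (insertSeq m 0# P) (insertSeq m 0# Q) ≈ evalX-interlacing f m P Q
    evalX-interlacing-stable m P Q =
      cancel (suc (double m)) (suc (double m)) a _ _ ℕP.≤-refl interlacing≋
      where
      a = 0# - prefixSum P m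
      P' = insertSeq m 0# P
      Q' = insertSeq m 0# Q
      interlacing≋ : interlacing (suc m) P' Q' ≋[ suc (suc (suc (double m))) ]
                     insertTwice (suc (double m)) a (interlacing m P Q)
      interlacing≋ l l< with pairPosition (suc (double m)) l
      ... | before l<j = begin
        interlacing (suc m) P' Q' l
          ≈⟨ +-cong (suffixSum-insertSeq-≤ ⌊ l /2⌋ m m Q
                       (half-mono-≡ˡ (ℕP.≤-pred l<j) (half-double m)) ℕP.≤-refl)
                    (-‿cong (prefixSum-insertSeq-≤ ⌊ suc l /2⌋ m 0# P
                               (half-mono-≡ˡ l<j (half-suc-double m)))) ⟩
        interlacing m P Q l
          ≡⟨ P.sym (insertTwice-before (suc (double m)) a (interlacing m P Q) l l<j) ⟩
        insertTwice (suc (double m)) a (interlacing m P Q) l ∎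
      ... | first = begin
        interlacing (suc m) P' Q' (suc (double m))
          ≡⟨ interlacing-odd (suc m) P' Q' m ⟩
        suffixSum (suc m) Q' m - prefixSum P' (suc m)
          ≈⟨ +-cong (trans (suffixSum-insertSeq-≤ m m m Q ℕP.≤-refl ℕP.≤-refl) (suffixSum-end m Q))
                    (-‿cong (prefixSum-insertSeq-≥ m m P ℕP.≤-refl)) ⟩
        a ≡⟨ P.sym (insertTwice-first (suc (double m)) a (interlacing m P Q)) ⟩
        insertTwice (suc (double m)) a (interlacing m P Q) (suc (double m)) ∎
      ... | second = begin
        interlacing (suc m) P' Q' (suc (suc (double m)))
          ≡⟨ interlacing-even (suc m) P' Q' (suc m) ⟩
        suffixSum (suc m) Q' (suc m) - prefixSum P' (suc m)
          ≈⟨ +-cong (trans (suffixSum-insertSeq-≥ m m m Q ℕP.≤-refl) (suffixSum-end m Q))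
                    (-‿cong (prefixSum-insertSeq-≥ m m P ℕP.≤-refl)) ⟩
        a ≡⟨ P.sym (insertTwice-second (suc (double m)) a (interlacing m P Q)) ⟩
        insertTwice (suc (double m)) a (interlacing m P Q) (suc (suc (double m))) ∎
      ... | after l' j≤l' = ⊥-elim (ℕP.<⇒≱ (ℕP.≤-pred (ℕP.≤-pred l<)) j≤l')

    evalX-interlacing-condQ : ∀ k j P Q → j ℕ.≤ k →
      evalX-interlacing f (suc k) P (insertSeq j 0# Q) ≈ evalX-interlacing f k (mergeSeq j P) Q
    evalX-interlacing-condQ k j P Q j≤k =
      cancel (suc (double k)) (suc (double j)) a _ _ (s≤s (double-mono-≤ j≤k)) interlacing≋
      where
      a = suffixSum k Q j - prefixSum P (suc j)
      Q' = insertSeq j 0# Q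
      Y = interlacing k (mergeSeq j P) Q
      interlacing≋ : interlacing (suc k) P Q' ≋[ suc (suc (suc (double k))) ]
                     insertTwice (suc (double j)) a Y
      interlacing≋ l _ with pairPosition (suc (double j)) l
      ... | before l<j = begin
        interlacing (suc k) P Q' l
          ≈⟨ +-cong (suffixSum-insertSeq-≤ ⌊ l /2⌋ j k Q
                       (half-mono-≡ˡ (ℕP.≤-pred l<j) (half-double j)) j≤k)
                    (-‿cong (sym (prefixSum-mergeSeq-≤ ⌊ suc l /2⌋ j P
                                    (half-mono-≡ˡ l<j (half-suc-double j))))) ⟩
        Y l ≡⟨ P.sym (insertTwice-before (suc (double j)) a Y l l<j) ⟩
        insertTwice (suc (double j)) a Y l ∎
      ... | first = begin
        interlacing (suc k) P Q' (suc (double j))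
          ≡⟨ interlacing-odd (suc k) P Q' j ⟩
        suffixSum (suc k) Q' j - prefixSum P (suc j)
          ≈⟨ +-congʳ (suffixSum-insertSeq-≤ j j k Q ℕP.≤-refl j≤k) ⟩
        a ≡⟨ P.sym (insertTwice-first (suc (double j)) a Y) ⟩
        insertTwice (suc (double j)) a Y (suc (double j)) ∎
      ... | second = begin
        interlacing (suc k) P Q' (suc (suc (double j)))
          ≡⟨ interlacing-even (suc k) P Q' (suc j) ⟩
        suffixSum (suc k) Q' (suc j) - prefixSum P (suc j)
          ≈⟨ +-congʳ (suffixSum-insertSeq-≥ j j k Q ℕP.≤-refl) ⟩
        a ≡⟨ P.sym (insertTwice-second (suc (double j)) a Y) ⟩
        insertTwice (suc (double j)) a Y (suc (suc (double j))) ∎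
      ... | after l' j≤l' = begin
        interlacing (suc k) P Q' (suc (suc l'))
          ≈⟨ +-cong (suffixSum-insertSeq-≥ j ⌊ l' /2⌋ k Q (half-mono-≡ʳ j≤l' (half-suc-double j)))
                    (-‿cong (sym (prefixSum-mergeSeq-> j ⌊ suc l' /2⌋ P
                                   (half-mono-≡ʳ (s≤s j≤l') (cong suc (half-double j)))))) ⟩
        Y l' ≡⟨ P.sym (insertTwice-after (suc (double j)) a Y l' j≤l') ⟩
        insertTwice (suc (double j)) a Y (suc (suc l')) ∎

    evalX-interlacing-condP-first : ∀ k P Q →
      evalX-interlacing f (suc k) (insertSeq 0 0# P) Q ≈ evalX-interlacing f k P (removeSeq 0 Q)
    evalX-interlacing-condP-first k P Q = cancel (suc (double k)) 0 a _ _ z≤n interlacing≋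
      where
      a = suffixSum (suc k) Q 0 - 0#
      Y = interlacing k P (removeSeq 0 Q)
      interlacing≋ : interlacing (suc k) (insertSeq 0 0# P) Q ≋[ suc (suc (suc (double k))) ]
                     insertTwice 0 a Y
      interlacing≋ l _ with pairPosition 0 l
      ... | first       = refl
      ... | second      = +-congˡ (-‿cong (+-identityˡ 0#))
      ... | after l' _  = +-congˡ (-‿cong (+-identityˡ _))

    evalX-interlacing-condP-later : ∀ k j P Q → j ℕ.< k →
      evalX-interlacing f (suc k) (insertSeq (suc j) 0# P) Q ≈ evalX-interlacing f k P (mergeSeq j Q)
    evalX-interlacing-condP-later k j P Q j<k =
      cancel (suc (double k)) (suc (suc (double j))) a _ _ (ℕP.m≤n⇒m≤1+n (double-mono-≤ j<k)) interlacing≋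
      where
      a = suffixSum (suc k) Q (suc j) - prefixSum P (suc j)
      P' = insertSeq (suc j) 0# P
      Y = interlacing k P (mergeSeq j Q)
      interlacing≋ : interlacing (suc k) P' Q ≋[ suc (suc (suc (double k))) ]
                     insertTwice (suc (suc (double j))) a Y
      interlacing≋ l _ with pairPosition (suc (suc (double j))) l
      ... | before l<j = begin
        interlacing (suc k) P' Q l
          ≈⟨ +-cong (sym (suffixSum-mergeSeq-≤ ⌊ l /2⌋ j k Q
                            (half-mono-≡ˡ (ℕP.≤-pred l<j) (half-suc-double j)) j<k))
                    (-‿cong (prefixSum-insertSeq-≤ ⌊ suc l /2⌋ (suc j) 0# P
                               (half-mono-≡ˡ l<j (cong suc (half-double j))))) ⟩
        Y l ≡⟨ P.sym (insertTwice-before (suc (suc (double j))) a Y l l<j) ⟩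
        insertTwice (suc (suc (double j))) a Y l ∎
      ... | first = begin
        interlacing (suc k) P' Q (suc (suc (double j)))
          ≡⟨ interlacing-even (suc k) P' Q (suc j) ⟩
        suffixSum (suc k) Q (suc j) - prefixSum P' (suc j)
          ≈⟨ +-congˡ (-‿cong (prefixSum-insertSeq-≤ (suc j) (suc j) 0# P ℕP.≤-refl)) ⟩
        a ≡⟨ P.sym (insertTwice-first (suc (suc (double j))) a Y) ⟩
        insertTwice (suc (suc (double j))) a Y (suc (suc (double j))) ∎
      ... | second = begin
        interlacing (suc k) P' Q (suc (suc (suc (double j))))
          ≡⟨ interlacing-odd (suc k) P' Q (suc j) ⟩
        suffixSum (suc k) Q (suc j) - prefixSum P' (suc (suc j))
          ≈⟨ +-congˡ (-‿cong (prefixSum-insertSeq-≥ (suc j) (suc j) P ℕP.≤-refl)) ⟩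
        a ≡⟨ P.sym (insertTwice-second (suc (suc (double j))) a Y) ⟩
        insertTwice (suc (suc (double j))) a Y (suc (suc (suc (double j)))) ∎
      ... | after l' j≤l' = begin
        interlacing (suc k) P' Q (suc (suc l'))
          ≈⟨ +-cong (sym (suffixSum-mergeSeq-> j ⌊ l' /2⌋ k Q (half-mono-≡ʳ j≤l' (cong suc (half-double j)))))
                    (-‿cong (prefixSum-insertSeq-≥ (suc j) ⌊ suc l' /2⌋ P
                               (half-mono-≡ʳ (ℕP.m≤n⇒m≤1+n j≤l') (cong suc (half-double j))))) ⟩
        Y l' ≡⟨ P.sym (insertTwice-after (suc (suc (double j))) a Y l' j≤l') ⟩
        insertTwice (suc (suc (double j))) a Y (suc (suc l')) ∎

  module PolySums {V : Set} = PartialSums {Poly V} _⊕_ (con 0#)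

  eval-total : ∀ {V} (ρ : V → K) m G →
    eval ρ (PolySums.total m G) ≡ total m (λ t → eval ρ (G t))
  eval-total ρ zero    G = P.refl
  eval-total ρ (suc m) G = cong (eval ρ (G 0) +_) (eval-total ρ m (λ t → G (suc t)))

  eval-suffixSum : ∀ {V} (ρ : V → K) m G i →
    eval ρ (PolySums.suffixSum m G i) ≡ suffixSum m (λ t → eval ρ (G t)) i
  eval-suffixSum ρ m       G zero    = eval-total ρ m G
  eval-suffixSum ρ zero    G (suc i) = P.refl
  eval-suffixSum ρ (suc m) G (suc i) = eval-suffixSum ρ m (λ t → G (suc t)) i

  eval-prefixSum : ∀ {V} (ρ : V → K) G i →
    eval ρ (PolySums.prefixSum G i) ≡ prefixSum (λ t → eval ρ (G t)) i
  eval-prefixSum ρ G zero    = P.refl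
  eval-prefixSum ρ G (suc i) = cong (eval ρ (G 0) +_) (eval-prefixSum ρ (λ t → G (suc t)) i)

  deg-total : ∀ {V} m (G : ℕ → Poly V) → (∀ t → deg (G t) ℕ.≤ 1) →
    deg (PolySums.total m G) ℕ.≤ 1
  deg-total zero    G G-lin = z≤n
  deg-total (suc m) G G-lin = ℕP.⊔-lub (G-lin 0) (deg-total m _ (λ t → G-lin (suc t)))

  deg-suffixSum : ∀ {V} m (G : ℕ → Poly V) i → (∀ t → deg (G t) ℕ.≤ 1) →
    deg (PolySums.suffixSum m G i) ℕ.≤ 1
  deg-suffixSum m       G zero    G-lin = deg-total m G G-lin
  deg-suffixSum zero    G (suc i) G-lin = z≤n
  deg-suffixSum (suc m) G (suc i) G-lin = deg-suffixSum m _ i (λ t → G-lin (suc t))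

  deg-prefixSum : ∀ {V} (G : ℕ → Poly V) i → (∀ t → deg (G t) ℕ.≤ 1) →
    deg (PolySums.prefixSum G i) ℕ.≤ 1
  deg-prefixSum G zero    G-lin = z≤n
  deg-prefixSum G (suc i) G-lin = ℕP.⊔-lub (G-lin 0) (deg-prefixSum _ i (λ t → G-lin (suc t)))

  finVar : ∀ {V} m → (Fin m → V) → ℕ → Poly V
  finVar m v t with t <? m
  ... | yes t<m = var (v (fromℕ< t<m))
  ... | no _    = con 0#

  deg-finVar : ∀ {V} m (v : Fin m → V) t → deg (finVar m v t) ℕ.≤ 1
  deg-finVar m v t with t <? m
  ... | yes _ = s≤s z≤n
  ... | no _  = z≤n

  eval-finVar : ∀ {V} m (ρ : V → K) (v : Fin m → V) (X : Seq) → (∀ i → ρ (v i) ≈ X (toℕ i)) →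
    X ≋[ m ] (λ t → eval ρ (finVar m v t))
  eval-finVar m ρ v X ρv≈X t t<m with t <? m
  ... | yes t<m' = sym (trans (ρv≈X _) (reflexive (cong X (FinP.toℕ-fromℕ< t<m'))))
  ... | no t≮m   = ⊥-elim (t≮m t<m)

  interlacingPoly : (m l : ℕ) → Poly (Fin m ⊎ Fin m)
  interlacingPoly m l =
    PolySums.suffixSum m (finVar m inj₂) ⌊ l /2⌋ ⊖ PolySums.prefixSum (finVar m inj₁) ⌊ suc l /2⌋

  -- h_m(p; q) = f_{2m+1}(IC(p; q)), the inverse of Φ_{p,q→x}
  Φx→pq : SeqX → SeqPQ
  Φx→pq f m = subst (λ k → interlacingPoly m (toℕ k)) (f (suc (double m)))

  deg-interlacingPoly : ∀ m l → deg (interlacingPoly m l) ℕ.≤ 1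
  deg-interlacingPoly m l = ℕP.⊔-lub
    (deg-suffixSum m (finVar m inj₂) ⌊ l /2⌋ (deg-finVar m inj₂))
    (deg-prefixSum (finVar m inj₁) ⌊ suc l /2⌋ (deg-finVar m inj₁))

  eval-interlacingPoly : ∀ m P Q l → l ℕ.≤ double m →
    eval [ (λ i → P (toℕ i)) , (λ i → Q (toℕ i)) ] (interlacingPoly m l) ≈ interlacing m P Q l
  eval-interlacingPoly m P Q l l≤2m = begin
    eval ρ (S ⊖ T)                     ≈⟨ eval-⊖ ρ S T ⟩
    eval ρ S - eval ρ T
      ≡⟨ cong₂ _-_ (eval-suffixSum ρ m (finVar m inj₂) ⌊ l /2⌋) (eval-prefixSum ρ (finVar m inj₁) ⌊ suc l /2⌋) ⟩
    suffixSum m Q′ ⌊ l /2⌋ - prefixSum P′ ⌊ suc l /2⌋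
      ≈⟨ +-cong (suffixSum-cong-≋ m ⌊ l /2⌋ (≋-sym (eval-finVar m ρ inj₂ Q (λ _ → refl))))
                (-‿cong (prefixSum-cong-≋ ⌊ suc l /2⌋ λ t t<i →
                   sym (eval-finVar m ρ inj₁ P (λ _ → refl) t
                          (ℕP.<-≤-trans t<i (half-mono-≡ˡ (s≤s l≤2m) (half-suc-double m)))))) ⟩
    interlacing m P Q l ∎
    where
    ρ = [ (λ i → P (toℕ i)) , (λ i → Q (toℕ i)) ]
    S = PolySums.suffixSum m (finVar m inj₂) ⌊ l /2⌋
    T = PolySums.prefixSum (finVar m inj₁) ⌊ suc l /2⌋
    P′ Q′ : Seq
    P′ t = eval ρ (finVar m inj₁ t)
    Q′ t = eval ρ (finVar m inj₂ t)

  evalSeqPQ-Φx→pq : ∀ f m P Q → evalSeqPQ (Φx→pq f) m P Q ≈ evalX-interlacing f m P Q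
  evalSeqPQ-Φx→pq f m P Q = begin
    eval ρ (subst σ (f (suc (double m))))         ≡⟨ eval-subst ρ σ (f (suc (double m))) ⟩
    eval (λ k → eval ρ (σ k)) (f (suc (double m)))
      ≈⟨ eval-cong (λ k → eval-interlacingPoly m P Q (toℕ k) (ℕP.≤-pred (FinP.toℕ<n k)))
                   (f (suc (double m))) ⟩
    evalX-interlacing f m P Q ∎
    where
    ρ = [ (λ i → P (toℕ i)) , (λ i → Q (toℕ i)) ]
    σ = λ (k : Fin (suc (double m))) → interlacingPoly m (toℕ k)

  Φx→pq-preserves-Sol : ∀ f → IsSol f → IsSol' (Φx→pq f)
  Φx→pq-preserves-Sol f ((d , f-deg) , _ , cancel) =
    (d , λ m → HasDegree≤-subst-linear _ (λ k → deg-interlacingPoly m (toℕ k)) {f (suc (double m))}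
                                       (f-deg (suc (double m)))) ,
    StablePQˢ⇒StablePQ h (λ m P Q → via (evalX-interlacing-stable f cancelˢ m P Q)) ,
    CondQˢ⇒CondQ h (λ k j P Q j≤k → via (evalX-interlacing-condQ f cancelˢ k j P Q j≤k)) ,
    CondPˢ⇒CondP h (λ k P Q → via (evalX-interlacing-condP-first f cancelˢ k P Q))
                   (λ k j P Q j<k → via (evalX-interlacing-condP-later f cancelˢ k j P Q j<k))
    where
    h = Φx→pq f
    cancelˢ = CancelX⇒CancelXˢ f cancel
    via : ∀ {m m' P P' Q Q'} → evalX-interlacing f m P Q ≈ evalX-interlacing f m' P' Q' →
      evalSeqPQ h m P Q ≈ evalSeqPQ h m' P' Q'
    via {m} {m'} {P} {P'} {Q} {Q'} eq =
      trans (evalSeqPQ-Φx→pq f m P Q) (trans eq (sym (evalSeqPQ-Φx→pq f m' P' Q')))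

  isEven-double : ∀ n → isEven (double n) ≡ true
  isEven-double zero    = P.refl
  isEven-double (suc n) = isEven-double n

  isEven-suc-double : ∀ n → isEven (suc (double n)) ≡ false
  isEven-suc-double zero    = P.refl
  isEven-suc-double (suc n) = isEven-suc-double n

  sum-drop≈suffixSum : ∀ {m} (q : Vec ℕ m) i →
    ι (sum (drop i (toList q))) ≈ suffixSum m (toSeq (Vec.map ι q)) i
  sum-drop≈suffixSum []      zero    = refl
  sum-drop≈suffixSum []      (suc i) = refl
  sum-drop≈suffixSum (x ∷ q) zero    = trans (ι-+ x (sum (toList q))) (+-congˡ (sum-drop≈suffixSum q zero))
  sum-drop≈suffixSum (x ∷ q) (suc i) = sum-drop≈suffixSum q i

  sum-take≈prefixSum : ∀ {m} (p : Vec ℕ m) i →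
    ι (sum (take i (toList p))) ≈ prefixSum (toSeq (Vec.map ι p)) i
  sum-take≈prefixSum []      zero    = refl
  sum-take≈prefixSum []      (suc i) = sym (trans (+-identityˡ _) (prefixSum-zeros i))
  sum-take≈prefixSum (x ∷ p) zero    = refl
  sum-take≈prefixSum (x ∷ p) (suc i) =
    trans (ι-+ x (sum (take i (toList p)))) (+-congˡ (sum-take≈prefixSum p i))

  pSeq qSeq : YoungDiagram → Seq
  pSeq λ' = toSeq (Vec.map ι (YoungDiagram.p λ'))
  qSeq λ' = toSeq (Vec.map ι (YoungDiagram.q λ'))

  ActY'≈evalSeqPQ : ∀ h λ' → ActY' h λ' ≈ evalSeqPQ h (YoungDiagram.m λ') (pSeq λ') (qSeq λ')
  ActY'≈evalSeqPQ h λ' =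
    evalPQ≈evalSeqPQ h (Vec.map ι (YoungDiagram.p λ')) (Vec.map ι (YoungDiagram.q λ'))

  icAt-halves : ∀ λ' l → let open YoungDiagram λ' in
    icAt λ' l ≡ ι (sum (drop ⌊ l /2⌋ (toList q))) - ι (sum (take ⌊ suc l /2⌋ (toList p)))
  icAt-halves λ' l with parity l
  ... | even j = P.trans (cong (if_then D - T ⌊ double j /2⌋ else D - T (suc ⌊ double j /2⌋)) (isEven-double j))
                         (cong (λ i → D - T i) (P.trans (half-double j) (P.sym (half-suc-double j))))
    where
    open YoungDiagram λ'
    D = ι (sum (drop ⌊ double j /2⌋ (toList q)))
    T = λ i → ι (sum (take i (toList p)))
  ... | odd j = P.trans (cong (if_then D - T ⌊ suc (double j) /2⌋ else D - T (suc ⌊ suc (double j) /2⌋))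
                              (isEven-suc-double j))
                        (cong (λ i → D - T (suc i)) (P.trans (half-suc-double j) (P.sym (half-double j))))
    where
    open YoungDiagram λ'
    D = ι (sum (drop ⌊ suc (double j) /2⌋ (toList q)))
    T = λ i → ι (sum (take i (toList p)))

  icAt≈interlacing : ∀ λ' l → icAt λ' l ≈ interlacing (YoungDiagram.m λ') (pSeq λ') (qSeq λ') l
  icAt≈interlacing λ' l = trans (reflexive (icAt-halves λ' l))
    (+-cong (sum-drop≈suffixSum q ⌊ l /2⌋) (-‿cong (sum-take≈prefixSum p ⌊ suc l /2⌋)))
    where open YoungDiagram λ'

  toSeq-IC≋interlacing : ∀ λ' → let m = YoungDiagram.m λ' in
    toSeq (IC λ') ≋[ suc (double m) ] interlacing m (pSeq λ') (qSeq λ')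
  toSeq-IC≋interlacing λ' l l<1+2m = begin
    toSeq (IC λ') l                 ≡⟨ toSeq-tabulate (λ k → icAt λ' (toℕ k)) l l<1+m+m ⟩
    icAt λ' (toℕ (fromℕ< l<1+m+m))   ≡⟨ cong (icAt λ') (FinP.toℕ-fromℕ< l<1+m+m) ⟩
    icAt λ' l                       ≈⟨ icAt≈interlacing λ' l ⟩
    interlacing m (pSeq λ') (qSeq λ') l ∎
    where
    open YoungDiagram λ'
    l<1+m+m : l ℕ.< suc (m ℕ.+ m)
    l<1+m+m = P.subst (λ z → l ℕ.< suc z) (double≡n+n m) l<1+2m

  ActY∘Φ≈ActY' : ∀ h λ' → ActY (Φpq→x h) λ' ≈ ActY' h λ'
  ActY∘Φ≈ActY' h λ' = begin
    evalX (Φpq→x h) (IC λ')                       ≈⟨ evalX-Φ h (IC λ') ⟩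
    evalSeqPQ h ⌊ suc (m ℕ.+ m) /2⌋ (pCoord X) (qCoord X)
      ≡⟨ cong (λ z → evalSeqPQ h z (pCoord X) (qCoord X)) half-[1+m+m] ⟩
    evalSeqPQ h m (pCoord X) (qCoord X)            ≈⟨ evalSeqPQ-cong h m pCoord≋ qCoord≋ ⟩
    evalSeqPQ h m (pSeq λ') (qSeq λ')              ≈⟨ sym (ActY'≈evalSeqPQ h λ') ⟩
    ActY' h λ'                                     ∎
    where
    open YoungDiagram λ'
    X = toSeq (IC λ')
    I = interlacing m (pSeq λ') (qSeq λ')
    half-[1+m+m] : ⌊ suc (m ℕ.+ m) /2⌋ ≡ m
    half-[1+m+m] = P.trans (cong (λ z → ⌊ suc z /2⌋) (P.sym (double≡n+n m))) (half-suc-double m)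
    X≈I : ∀ {l} → l ℕ.≤ double m → X l ≈ I l
    X≈I l≤2m = toSeq-IC≋interlacing λ' _ (s≤s l≤2m)
    pCoord≋ : pCoord X ≋[ m ] pSeq λ'
    pCoord≋ t t<m = trans
      (+-cong (X≈I (ℕP.≤-trans (ℕP.n≤1+n _) (ℕP.≤-trans (ℕP.n≤1+n _) (double-mono-< t<m))))
              (-‿cong (X≈I (ℕP.≤-trans (ℕP.n≤1+n _) (double-mono-< t<m)))))
      (pCoord-interlacing m (pSeq λ') (qSeq λ') t)
    qCoord≋ : qCoord X ≋[ m ] qSeq λ'
    qCoord≋ t t<m = trans
      (+-cong (X≈I (ℕP.≤-trans (ℕP.n≤1+n _) (double-mono-< t<m)))
              (-‿cong (X≈I (double-mono-< t<m))))
      (qCoord-interlacing m (pSeq λ') (qSeq λ') t t<m)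

  ActY'∘Φx→pq≈ActY : ∀ f λ' → ActY' (Φx→pq f) λ' ≈ ActY f λ'
  ActY'∘Φx→pq≈ActY f λ' = begin
    ActY' (Φx→pq f) λ'                              ≈⟨ ActY'≈evalSeqPQ (Φx→pq f) λ' ⟩
    evalSeqPQ (Φx→pq f) m (pSeq λ') (qSeq λ')       ≈⟨ evalSeqPQ-Φx→pq f m (pSeq λ') (qSeq λ') ⟩
    evalX-interlacing f m (pSeq λ') (qSeq λ')
      ≈⟨ evalSeqX-cong f (suc (double m)) (≋-sym (toSeq-IC≋interlacing λ')) ⟩
    evalSeqX f (suc (double m)) (toSeq (IC λ'))
      ≡⟨ cong (λ z → evalSeqX f (suc z) (toSeq (IC λ'))) (double≡n+n m) ⟩
    evalSeqX f (suc (m ℕ.+ m)) (toSeq (IC λ'))       ≈⟨ sym (evalX≈evalSeqX f (IC λ')) ⟩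
    ActY f λ'                                       ∎
    where open YoungDiagram λ'

  -- Multirectangular coordinates range over all positive integers, and a
  -- polynomial over a field of characteristic 0 is determined by its values there.
  ActY'-injective : ∀ h h' → (∀ λ' → ActY' h λ' ≈ ActY' h' λ') → h ≃PQ h'
  ActY'-injective h h' same-action m ρ =
    equal-on-positive-integer-points (h m) (h' m) agree-at-diagrams variables ρ
      (λ v v∉ → ⊥-elim (v∉ (every-variable v)))
    where
    open OneVariableAtATime {Fin m ⊎ Fin m} (SumP.≡-dec FinP._≟_ FinP._≟_)
    variables : List (Fin m ⊎ Fin m)
    variables = List.map inj₁ (List.allFin m) ++ List.map inj₂ (List.allFin m)
    every-variable : ∀ v → v ∈ variables
    every-variable (inj₁ i) = ∈-++⁺ˡ (∈-map⁺ inj₁ (∈-allFin i))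
    every-variable (inj₂ i) = ∈-++⁺ʳ (List.map inj₁ (List.allFin m)) (∈-map⁺ inj₂ (∈-allFin i))
    agree-at-diagrams : ∀ ρ → (∀ v → PositiveInteger (ρ v)) → eval ρ (h m) ≈ eval ρ (h' m)
    agree-at-diagrams ρ ρ-pos = begin
      eval ρ (h m)    ≈⟨ eval-cong ρ≈λ' (h m) ⟩
      ActY' h λ'      ≈⟨ same-action λ' ⟩
      ActY' h' λ'     ≈⟨ sym (eval-cong ρ≈λ' (h' m)) ⟩
      eval ρ (h' m)   ∎
      where
      size : Fin m ⊎ Fin m → ℕ
      size v = suc (proj₁ (ρ-pos v))
      sizes : (Fin m → Fin m ⊎ Fin m) → Vec ℕ m
      sizes side = Vec.tabulate (size ∘ side)
      lookup-sizes : ∀ side i → lookup (sizes side) i ≡ size (side i)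
      lookup-sizes side = VecP.lookup∘tabulate (size ∘ side)
      λ' : YoungDiagram
      λ' = record
        { m = m ; p = sizes inj₁ ; q = sizes inj₂
        ; p-pos = λ i → P.subst (0 ℕ.<_) (P.sym (lookup-sizes inj₁ i)) z<s
        ; q-pos = λ i → P.subst (0 ℕ.<_) (P.sym (lookup-sizes inj₂ i)) z<s }
      ρ≈sizes : ∀ side i → ρ (side i) ≈ lookup (Vec.map ι (sizes side)) i
      ρ≈sizes side i = trans (proj₂ (ρ-pos (side i)))
        (reflexive (P.sym (P.trans (VecP.lookup-map i ι (sizes side)) (cong ι (lookup-sizes side i)))))
      ρ≈λ' : ∀ v → ρ v ≈ [ lookup (Vec.map ι (sizes inj₁)) , lookup (Vec.map ι (sizes inj₂)) ] v
      ρ≈λ' (inj₁ i) = ρ≈sizes inj₁ i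
      ρ≈λ' (inj₂ i) = ρ≈sizes inj₂ i

corollary4p5 : (F : CharZeroField) →
  let open Theory F
      open CommutativeRing (CharZeroField.cring F) using (_≈_)
  in
  (∀ h → IsSol' h → IsSol (Φpq→x h))
  × (∀ h (λ' : YoungDiagram) → ActY (Φpq→x h) λ' ≈ ActY' h λ')
  × (∀ h h' → IsSol' h → IsSol' h' →
       (∀ λ' → ActY' h λ' ≈ ActY' h' λ') → h ≃PQ h')
  × (∀ f → IsSol f → ∃ λ h → IsSol' h × (∀ λ' → ActY' h λ' ≈ ActY f λ'))
corollary4p5 F =
  Φ-preserves-Sol F ,
  ActY∘Φ≈ActY' F ,
  (λ h h' _ _ → ActY'-injective F h h') ,
  λ f f∈Sol → Φx→pq F f , Φx→pq-preserves-Sol F f f∈Sol , ActY'∘Φx→pq≈ActY F f
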